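{- Let $G$ be a finite connected simple graph. Then $G$ is a bridgeless chordal graph without $K_5$-minor if and only if $G$ is obtained from copies of $K_3$ and $K_4$ by (repeated) $0$-, $1$- and $2$-sums.
   Context: For graphs $G_1=(V_1,E_1)$, $G_2=(V_2,E_2)$ such that $V_1\cap V_2$ is a clique in both, the clique sum is the graph with vertex set $V_1\cup V_2$ and edge set $E_1\cup E_2$; if $|V_1\cap V_2|=k+1$ it is called a $k$-sum. $K_r$ denotes the complete graph on $r$ vertices. A graph is chordal if it has no induced (chordless) cycle of length $\ge 4$; an edge is a bridge if no cycle contains it; bridgeless means having no bridge. A minor is obtained by deleting/contracting edges and deleting vertices. -}

module Defs where

open import Data.Nat using (ℕ; zero; suc; _≤_; _%_)
open import Data.Fin using (Fin; toℕ; _≟_)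
open import Data.Fin.Properties using (≡-decSetoid)
open import Data.Bool using (Bool; true; false; T; not)
open import Data.Maybe using (Maybe; just)
open import Data.Product using (Σ; ∃; _×_; _,_)
open import Data.Sum using (_⊎_)
open import Data.Unit using (⊤)
open import Relation.Nullary using (¬_; yes; no)
open import Relation.Nullary.Decidable using (⌊_⌋)
open import Relation.Binary.PropositionalEquality using (_≡_; _≢_; refl; sym)
open import Function.Definitions using (Injective)

record Graph (n : ℕ) : Set where
  field
    adj        : Fin n → Fin n → Bool
    adj-sym    : ∀ u v → adj u v ≡ adj v u
    adj-irrefl : ∀ v → adj v v ≡ false

Adj : ∀ {n} → Graph n → Fin n → Fin n → Set
Adj G u v = T (Graph.adj G u v)

private
  neq : ∀ {r} → Fin r → Fin r → Bool
  neq i j = not ⌊ i ≟ j ⌋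

  neq-sym : ∀ {r} (i j : Fin r) → neq i j ≡ neq j i
  neq-sym i j with i ≟ j | j ≟ i
  ... | yes _ | yes _ = refl
  ... | no _  | no _  = refl
  ... | yes p | no q  with q (sym p)
  ... | ()
  neq-sym i j | no q | yes p with q (sym p)
  ... | ()

  neq-irrefl : ∀ {r} (i : Fin r) → neq i i ≡ false
  neq-irrefl i with i ≟ i
  ... | yes _ = refl
  ... | no q with q refl
  ... | ()

K : (r : ℕ) → Graph r
K r = record { adj = neq ; adj-sym = neq-sym ; adj-irrefl = neq-irrefl }

IsComplete : ∀ {n} → Graph n → Set
IsComplete G = ∀ u v → u ≢ v → Adj G u v

data WalkIn {n} (G : Graph n) (P : Fin n → Set) : Fin n → Fin n → Set where
  here : ∀ {v} → P v → WalkIn G P v v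
  step : ∀ {u w v} → P u → Adj G u w → WalkIn G P w v → WalkIn G P u v

Connected : ∀ {n} → Graph n → Set
Connected G = ∀ u v → WalkIn G (λ _ → ⊤) u v

-- Cycles, given as injective maps c : Fin (suc m) → Fin n with
-- c i adjacent to c (i+1 mod (suc m)); the cycle has length suc m.

Follows : ∀ {m} → Fin (suc m) → Fin (suc m) → Set
Follows {m} i j = toℕ j ≡ suc (toℕ i) % suc m

IsCycle : ∀ {n m} → Graph n → (Fin (suc m) → Fin n) → Set
IsCycle {m = m} G c =
  2 ≤ m × Injective _≡_ _≡_ c × (∀ i j → Follows i j → Adj G (c i) (c j))

Chordless : ∀ {n m} → Graph n → (Fin (suc m) → Fin n) → Set
Chordless G c = ∀ i j → Adj G (c i) (c j) → Follows i j ⊎ Follows j i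

-- no chordless (induced) cycle of length ≥ 4  (length = suc m, m ≥ 3)
Chordal : ∀ {n} → Graph n → Set
Chordal G = ∀ m (c : Fin (suc m) → _) → 3 ≤ m → IsCycle G c → ¬ Chordless G c

CycleContainsEdge : ∀ {n m} → (Fin (suc m) → Fin n) → Fin n → Fin n → Set
CycleContainsEdge c u v =
  ∃ λ i → ∃ λ j → Follows i j × ((c i ≡ u × c j ≡ v) ⊎ (c i ≡ v × c j ≡ u))

IsBridge : ∀ {n} → Graph n → Fin n → Fin n → Set
IsBridge G u v =
  Adj G u v × ¬ (Σ ℕ λ m → Σ (Fin (suc m) → _) λ c → IsCycle G c × CycleContainsEdge c u v)

Bridgeless : ∀ {n} → Graph n → Set
Bridgeless G = ∀ u v → ¬ IsBridge G u v

-- Minors (via branch sets / minor models): H is a minor of G iff there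
-- are disjoint nonempty connected vertex sets of G, one per vertex of H,
-- with an edge of G between the sets of any two adjacent vertices of H.

HasMinor : ∀ {m n} → Graph m → Graph n → Set
HasMinor {m} {n} H G =
  Σ (Fin n → Maybe (Fin m)) λ β →
      (∀ a → ∃ λ v → β v ≡ just a)
    × (∀ a u v → β u ≡ just a → β v ≡ just a → WalkIn G (λ w → β w ≡ just a) u v)
    × (∀ a b → Adj H a b → ∃ λ u → ∃ λ v → β u ≡ just a × β v ≡ just b × Adj G u v)

-- G is a k-sum of G₁ and G₂ (k ≤ 2) if G₁ and G₂ are
-- (identified with) induced subgraphs of G via injections f₁, f₂ such that
-- V = V₁ ∪ V₂, E = E₁ ∪ E₂, and V₁ ∩ V₂ consists of exactly k+1 vertices
-- (enumerated injectively by g) forming a clique.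

InImage : ∀ {a b} → (Fin a → Fin b) → Fin b → Set
InImage f v = ∃ λ i → f i ≡ v

record CliqueSum {n₁ n₂ n} (G₁ : Graph n₁) (G₂ : Graph n₂) (G : Graph n) (k : ℕ) : Set where
  field
    f₁      : Fin n₁ → Fin n
    f₂      : Fin n₂ → Fin n
    f₁-inj  : Injective _≡_ _≡_ f₁
    f₂-inj  : Injective _≡_ _≡_ f₂
    f₁-adj  : ∀ i j → Graph.adj G₁ i j ≡ Graph.adj G (f₁ i) (f₁ j)
    f₂-adj  : ∀ i j → Graph.adj G₂ i j ≡ Graph.adj G (f₂ i) (f₂ j)
    cover   : ∀ v → InImage f₁ v ⊎ InImage f₂ v
    edges   : ∀ u v → Adj G u v →
                (InImage f₁ u × InImage f₁ v) ⊎ (InImage f₂ u × InImage f₂ v)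
    g       : Fin (suc k) → Fin n
    g-inj   : Injective _≡_ _≡_ g
    g-inter : ∀ v → (InImage f₁ v × InImage f₂ v) → InImage g v
    inter-g : ∀ t → InImage f₁ (g t) × InImage f₂ (g t)
    clique  : ∀ s t → s ≢ t → Adj G (g s) (g t)

data Built : ∀ {n} → Graph n → Set where
  base₃ : (G : Graph 3) → IsComplete G → Built G
  base₄ : (G : Graph 4) → IsComplete G → Built G
  sum   : ∀ {n₁ n₂ n} {G₁ : Graph n₁} {G₂ : Graph n₂} (G : Graph n) (k : ℕ) →
          k ≤ 2 → Built G₁ → Built G₂ → CliqueSum G₁ G₂ G k → Built G

{-# OPTIONS --safe #-}

-- Backward direction: K₃ and K₄ have the three properties, and clique sums
-- along at most three vertices preserve them.  A cycle of a summand is a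
-- cycle of the sum; a chordless cycle meeting both sides would cross the
-- separating clique in two non-consecutive vertices, giving a chord; and a K₅
-- model has a branch set missing the (at most three) separator vertices,
-- which lets the whole model be pulled into the summand containing it.
--
-- Forward direction, by induction on the number of vertices.  A complete
-- graph is K₃ or K₄, since K₂ has a bridge and larger ones contain K₅.
-- Otherwise take non-adjacent a, b, the component C of b in G − N[a] and its
-- boundary S.  Chordality makes S a clique, and |S| ≥ 4 would give a K₅
-- minor, so G is a ≤2-sum of the smaller graphs G − C and G[C ∪ S].  These
-- inherit the three properties; for bridgelessness one uses that in a
-- bridgeless chordal graph every edge lies on a triangle.
module Submission where

open import Defs
open import Data.Bool using (T)
open import Data.Bool.Properties using (T?)
open import Data.Empty using (⊥; ⊥-elim)
open import Data.Fin using (Fin; toℕ; fromℕ; fromℕ<; _≟_; inject₁; inject≤; cast) renaming (zero to fz; suc to fs)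
open import Data.Fin.Properties
  using (toℕ-injective; toℕ<n; toℕ-fromℕ<; any?; all?; ¬∀⟶∃¬; injective⇒≤; inject₁-injective;
         inject≤-injective; fromℕ≢inject₁; cast-involutive)
open import Data.Fin.Relation.Unary.Top using (view; ‵fromℕ; ‵inject₁)
open import Data.List using (List; []; _∷_; length; lookup; filter; allFin)
open import Data.List.Membership.Propositional using (_∈_; _∉_)
open import Data.List.Membership.Propositional.Properties using (∈-lookup; ∈-allFin; ∈-filter⁺; ∈-filter⁻)
open import Data.List.Relation.Unary.All using (All; []; _∷_)
import Data.List.Relation.Unary.All as All
open import Data.List.Relation.Unary.AllPairs using ([]; _∷_)
open import Data.List.Relation.Unary.All.Properties using (¬Any⇒All¬)
open import Data.List.Relation.Unary.Any using (Any; here; there)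
import Data.List.Relation.Unary.Any as Any
open import Data.List.Relation.Unary.Any.Properties using (lookup-index)
open import Data.List.Relation.Unary.Unique.Propositional using (Unique)
open import Data.List.Relation.Unary.Unique.Propositional.Properties using (allFin⁺; filter⁺)
open import Data.Maybe using (Maybe; just; nothing)
open import Data.Maybe.Properties using (just-injective) renaming (≡-dec to ≡-dec-Maybe)
open import Data.Nat using (ℕ; zero; suc; _≤_; _<_; z≤n; s≤s; _+_; _≤?_; _%_)
open import Data.Nat.DivMod using (m<n⇒m%n≡m; n%n≡0)
open import Data.Nat.Induction using (<-rec)
open import Data.Nat.Properties
  using (m≤n⇒m<n∨m≡n; ≤-trans; ≤-refl; <-trans; ≤-<-trans; <-≤-trans; n<1+n; m≤n⇒m≤1+n; ≤-pred; <-irrefl;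
         <⇒≢; n≮0; ≰⇒>; <-cmp; suc-injective)
open import Data.Product using (Σ; ∃; _×_; _,_; proj₁; proj₂)
open import Data.Sum using (_⊎_; inj₁; inj₂; swap)
open import Data.Unit using (⊤; tt)
open import Function using (_∘_; id; case_of_)
open import Function.Bundles using (_⇔_; mk⇔)
open import Function.Definitions using (Injective)
open import Relation.Binary.Definitions using (tri<; tri>; tri≈)
open import Relation.Binary.PropositionalEquality using (_≡_; _≢_; refl; sym; trans; cong; subst)
open import Relation.Nullary using (¬_; Dec; yes; no)
open import Relation.Nullary.Decidable using (_×-dec_; _⊎-dec_; ¬?; decidable-stable)
open import Relation.Unary using (Decidable)

lookup-injective : ∀ {n} {xs : List (Fin n)} → Unique xs → ∀ {i j} → lookup xs i ≡ lookup xs j → i ≡ j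
lookup-injective {xs = x ∷ xs} (x∉ ∷ u) {fz}   {fz}   eq = refl
lookup-injective {xs = x ∷ xs} (x∉ ∷ u) {fz}   {fs j} eq = ⊥-elim (All.lookup x∉ (∈-lookup j) eq)
lookup-injective {xs = x ∷ xs} (x∉ ∷ u) {fs i} {fz}   eq = ⊥-elim (All.lookup x∉ (∈-lookup i) (sym eq))
lookup-injective {xs = x ∷ xs} (x∉ ∷ u) {fs i} {fs j} eq = cong fs (lookup-injective u eq)

unique-length≤ : ∀ {n} {xs : List (Fin n)} → Unique xs → length xs ≤ n
unique-length≤ u = injective⇒≤ (lookup-injective u)

follows-cases : ∀ {m} (i j : Fin (suc m)) → Follows i j →
                toℕ j ≡ suc (toℕ i) ⊎ (toℕ i ≡ m × toℕ j ≡ 0)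
follows-cases {m} i j f with m≤n⇒m<n∨m≡n (≤-pred (toℕ<n i))
... | inj₁ lt = inj₁ (trans f (m<n⇒m%n≡m (s≤s lt)))
... | inj₂ eq = inj₂ (eq , trans f (trans (cong (λ t → suc t % suc m) eq) (n%n≡0 (suc m))))

follows-suc : ∀ {m} (i j : Fin (suc m)) → toℕ j ≡ suc (toℕ i) → Follows i j
follows-suc {m} i j e = trans e (sym (m<n⇒m%n≡m (subst (_< suc m) e (toℕ<n j))))

follows-wrap : ∀ {m} (i j : Fin (suc m)) → toℕ i ≡ m → toℕ j ≡ 0 → Follows i j
follows-wrap {m} i j ei ej = trans ej (sym (trans (cong (λ t → suc t % suc m) ei) (n%n≡0 (suc m))))

-- Walks, induced paths and cycles

module Props {n : ℕ} (G : Graph n) where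

  adj? : ∀ u v → Dec (Adj G u v)
  adj? u v = T? (Graph.adj G u v)

  Adj-sym : ∀ {u v} → Adj G u v → Adj G v u
  Adj-sym {u} {v} = subst T (Graph.adj-sym G u v)

  Adj-irrefl : ∀ {v} → ¬ Adj G v v
  Adj-irrefl {v} = subst T (Graph.adj-irrefl G v)

  Adj⇒≢ : ∀ {u v} → Adj G u v → u ≢ v
  Adj⇒≢ p refl = Adj-irrefl p

  Adj-resp : ∀ {x x′ y y′} → x ≡ x′ → y ≡ y′ → Adj G x y → Adj G x′ y′
  Adj-resp refl refl a = a

  walk-head : ∀ {P u v} → WalkIn G P u v → P u
  walk-head (here p)     = p
  walk-head (step p _ _) = p

  walk-last : ∀ {P u v} → WalkIn G P u v → P v
  walk-last (here p)     = p
  walk-last (step _ _ w) = walk-last w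

  walk-map : ∀ {P Q : Fin n → Set} {u v} → (∀ {x} → P x → Q x) → WalkIn G P u v → WalkIn G Q u v
  walk-map f (here p)     = here (f p)
  walk-map f (step p a w) = step (f p) a (walk-map f w)

  walk-++ : ∀ {P u w v} → WalkIn G P u w → WalkIn G P w v → WalkIn G P u v
  walk-++ (here _)      w₂ = w₂
  walk-++ (step p a w₁) w₂ = step p a (walk-++ w₁ w₂)

  walk-snoc : ∀ {P u w v} → WalkIn G P u w → Adj G w v → P v → WalkIn G P u v
  walk-snoc W a p = walk-++ W (step (walk-last W) a (here p))

  walk-reverse : ∀ {P u v} → WalkIn G P u v → WalkIn G P v u
  walk-reverse (here p)     = here p
  walk-reverse (step p a w) = walk-snoc (walk-reverse w) (Adj-sym a) p

  data InducedPath (P : Fin n → Set) : Fin n → Fin n → List (Fin n) → Set where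
    single : ∀ {v} → P v → InducedPath P v v (v ∷ [])
    cons   : ∀ {u w v xs} → P u → Adj G u w → InducedPath P w v (w ∷ xs) →
             u ∉ (w ∷ xs) → All (λ z → ¬ Adj G u z) xs → InducedPath P u v (u ∷ w ∷ xs)

  path-head∈ : ∀ {P u v xs} → InducedPath P u v xs → u ∈ xs
  path-head∈ (single _)       = here refl
  path-head∈ (cons _ _ _ _ _) = here refl

  path-all : ∀ {P u v xs} → InducedPath P u v xs → All P xs
  path-all (single p)       = p ∷ []
  path-all (cons p _ q _ _) = p ∷ path-all q

  path-unique : ∀ {P u v xs} → InducedPath P u v xs → Unique xs
  path-unique (single _)                          = [] ∷ []
  path-unique (cons {w = w} {xs = xs} _ _ q u∉ _) = ¬Any⇒All¬ (w ∷ xs) u∉ ∷ path-unique q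

  path-suffix : ∀ {P u v x xs} → InducedPath P u v xs → x ∈ xs →
                Σ (List (Fin n)) λ ys → InducedPath P x v ys
  path-suffix q@(single _)       (here refl) = _ , q
  path-suffix q@(cons _ _ _ _ _) (here refl) = _ , q
  path-suffix (single _)         (there ())
  path-suffix (cons _ _ q _ _)   (there m)   = path-suffix q m

  path-from-last-neighbour :
    ∀ {P w v xs} u → InducedPath P w v xs → Any (Adj G u) xs →
    Σ (Fin n) λ z → Σ (List (Fin n)) λ ys → InducedPath P z v (z ∷ ys) × Adj G u z ×
      All (λ t → ¬ Adj G u t) ys × (∀ {y} → y ∈ (z ∷ ys) → y ∈ xs)
  path-from-last-neighbour u (single p) (here a) = _ , [] , single p , a , [] , id
  path-from-last-neighbour u (cons {w = w} {xs = xs} p a q u∉ na) an with Any.any? (adj? u) (w ∷ xs)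
  ... | yes an′ with path-from-last-neighbour u q an′
  ...   | z , ys , r , az , nz , sub = z , ys , r , az , nz , there ∘ sub
  path-from-last-neighbour u (cons {w = w} {xs = xs} p a q u∉ na) (here a′) | no ¬an =
    _ , _ , cons p a q u∉ na , a′ , ¬Any⇒All¬ (w ∷ xs) ¬an , id
  path-from-last-neighbour u (cons p a q u∉ na) (there an) | no ¬an = ⊥-elim (¬an an)

  -- Cut the path at u if it already occurs on it, and otherwise at the last
  -- neighbour of u; either way the result stays induced.
  path-prepend : ∀ {P u w v xs} → P u → Adj G u w → InducedPath P w v xs →
                 Σ (List (Fin n)) λ ys → InducedPath P u v ys
  path-prepend {u = u} {xs = xs} pu a q with Any.any? (u ≟_) xs
  ... | yes u∈ = path-suffix q u∈
  ... | no u∉ with path-from-last-neighbour u q (Any.map (λ { refl → a }) (path-head∈ q))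
  ...   | z , ys , r , az , nz , sub = _ , cons pu az r (u∉ ∘ sub) nz

  walk⇒path : ∀ {P u v} → WalkIn G P u v → Σ (List (Fin n)) λ xs → InducedPath P u v xs
  walk⇒path (here p)     = _ , single p
  walk⇒path (step p a w) = path-prepend p a (proj₂ (walk⇒path w))

  -- Walks with at most k edges.  Walks are decidable because a walk can be
  -- shortened to an induced path, which has at most n vertices.
  WalkWithin : (P : Fin n → Set) → ℕ → Fin n → Fin n → Set
  WalkWithin P zero    u v = P u × u ≡ v
  WalkWithin P (suc k) u v = (P u × u ≡ v) ⊎ (P u × Σ (Fin n) λ w → Adj G u w × WalkWithin P k w v)

  walkWithin? : ∀ {P : Fin n → Set} → Decidable P → ∀ k u v → Dec (WalkWithin P k u v)
  walkWithin? P? zero    u v = P? u ×-dec (u ≟ v)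
  walkWithin? P? (suc k) u v =
    (P? u ×-dec (u ≟ v)) ⊎-dec (P? u ×-dec any? (λ w → adj? u w ×-dec walkWithin? P? k w v))

  walkWithin⇒walk : ∀ {P} k {u v} → WalkWithin P k u v → WalkIn G P u v
  walkWithin⇒walk zero    (p , refl)               = here p
  walkWithin⇒walk (suc k) (inj₁ (p , refl))        = here p
  walkWithin⇒walk (suc k) (inj₂ (p , w , a , r)) = step p a (walkWithin⇒walk k r)

  walkWithin-mono : ∀ {P} k k′ {u v} → k ≤ k′ → WalkWithin P k u v → WalkWithin P k′ u v
  walkWithin-mono zero    zero     _       r                      = r
  walkWithin-mono zero    (suc k′) _       r                      = inj₁ r
  walkWithin-mono (suc k) (suc k′) _       (inj₁ r)               = inj₁ r
  walkWithin-mono (suc k) (suc k′) (s≤s le) (inj₂ (p , w , a , r)) = inj₂ (p , w , a , walkWithin-mono k k′ le r)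

  path⇒walkWithin : ∀ {P u v xs} → InducedPath P u v xs → WalkWithin P (length xs) u v
  path⇒walkWithin (single p)       = inj₁ (p , refl)
  path⇒walkWithin (cons p a q _ _) = inj₂ (p , _ , a , path⇒walkWithin q)

  walk? : ∀ {P} → Decidable P → ∀ u v → Dec (WalkIn G P u v)
  walk? P? u v with walkWithin? P? n u v
  ... | yes r = yes (walkWithin⇒walk n r)
  ... | no ¬r = no λ w → let xs , q = walk⇒path w in
    ¬r (walkWithin-mono _ n (unique-length≤ (path-unique q)) (path⇒walkWithin q))

  path-adj-consecutive : ∀ {P u v xs} → InducedPath P u v xs →
                         ∀ i j → toℕ j ≡ suc (toℕ i) → Adj G (lookup xs i) (lookup xs j)
  path-adj-consecutive (cons _ a _ _ _) fz     (fs fz)     _ = a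
  path-adj-consecutive (cons _ _ q _ _) (fs i) (fs j)      e = path-adj-consecutive q i j (suc-injective e)
  path-adj-consecutive (single _)       fz     fz          ()
  path-adj-consecutive (cons _ _ _ _ _) fz     fz          ()
  path-adj-consecutive (cons _ _ _ _ _) fz     (fs (fs _)) ()
  path-adj-consecutive (cons _ _ _ _ _) (fs _) fz          ()

  path-adj⇒consecutive : ∀ {P u v xs} → InducedPath P u v xs → ∀ i j → Adj G (lookup xs i) (lookup xs j) →
                         toℕ j ≡ suc (toℕ i) ⊎ toℕ i ≡ suc (toℕ j)
  path-adj⇒consecutive (single _)        fz          fz          a = ⊥-elim (Adj-irrefl a)
  path-adj⇒consecutive (cons _ _ _ _ _)  fz          fz          a = ⊥-elim (Adj-irrefl a)
  path-adj⇒consecutive (cons _ _ _ _ _)  fz          (fs fz)     a = inj₁ refl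
  path-adj⇒consecutive (cons _ _ _ _ na) fz          (fs (fs k)) a = ⊥-elim (All.lookup na (∈-lookup k) a)
  path-adj⇒consecutive (cons _ _ _ _ _)  (fs fz)     fz          a = inj₂ refl
  path-adj⇒consecutive (cons _ _ _ _ na) (fs (fs k)) fz          a = ⊥-elim (All.lookup na (∈-lookup k) (Adj-sym a))
  path-adj⇒consecutive (cons _ _ q _ _)  (fs i)      (fs j)      a with path-adj⇒consecutive q i j a
  ... | inj₁ e = inj₁ (cong suc e)
  ... | inj₂ e = inj₂ (cong suc e)

  path-lookup-0 : ∀ {P u v xs} → InducedPath P u v xs → ∀ j → toℕ j ≡ 0 → lookup xs j ≡ u
  path-lookup-0 (single _)       fz _ = refl
  path-lookup-0 (cons _ _ _ _ _) fz _ = refl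

  path-lookup-last : ∀ {P u v xs} → InducedPath P u v xs → ∀ i → suc (toℕ i) ≡ length xs → lookup xs i ≡ v
  path-lookup-last (single _)       fz     _ = refl
  path-lookup-last (cons _ _ q _ _) (fs i) e = path-lookup-last q i (suc-injective e)

  path-last-index : ∀ {P u v xs} → InducedPath P u v xs → Σ (Fin (length xs)) λ i → suc (toℕ i) ≡ length xs
  path-last-index (single _)       = fz , refl
  path-last-index (cons _ _ q _ _) = let i , e = path-last-index q in fs i , cong suc e

  path-lookup≡head : ∀ {P u v xs} → InducedPath P u v xs → ∀ j → lookup xs j ≡ u → toℕ j ≡ 0
  path-lookup≡head (single _)        fz     _ = refl
  path-lookup≡head (cons _ _ _ _ _)  fz     _ = refl
  path-lookup≡head (cons _ _ _ u∉ _) (fs j) e = ⊥-elim (u∉ (subst (_∈ _) e (∈-lookup j)))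

  path-lookup≡last : ∀ {P u v xs} → InducedPath P u v xs → ∀ j → lookup xs j ≡ v → suc (toℕ j) ≡ length xs
  path-lookup≡last q j e with path-last-index q
  ... | i , ei with lookup-injective (path-unique q) {j} {i} (trans e (sym (path-lookup-last q i ei)))
  ...   | refl = ei

  path-length≥2 : ∀ {P u v xs} → InducedPath P u v xs → u ≢ v → 2 ≤ length xs
  path-length≥2 (single _)       u≢v = ⊥-elim (u≢v refl)
  path-length≥2 (cons _ _ _ _ _) _   = s≤s (s≤s z≤n)

  module Closing {P x y xs} (z : Fin n) (q : InducedPath P x y xs) (z∉ : z ∉ xs)
                 (zx : Adj G z x) (zy : Adj G z y) (len : 2 ≤ length xs) where

    cycle : Fin (suc (length xs)) → Fin n
    cycle = lookup (z ∷ xs)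

    cycle-isCycle : IsCycle G cycle
    cycle-isCycle = len , lookup-injective (¬Any⇒All¬ xs z∉ ∷ path-unique q) , adjacent
      where
      adjacent : ∀ i j → Follows i j → Adj G (cycle i) (cycle j)
      adjacent i j f with follows-cases i j f
      adjacent fz     fz     f | inj₁ ()
      adjacent fz     (fs j) f | inj₁ e       = subst (Adj G z) (sym (path-lookup-0 q j (suc-injective e))) zx
      adjacent (fs i) fz     f | inj₁ ()
      adjacent (fs i) (fs j) f | inj₁ e       = path-adj-consecutive q i j (suc-injective e)
      adjacent fz     j      f | inj₂ (e , _) = ⊥-elim (<⇒≢ (≤-trans (s≤s z≤n) len) e)
      adjacent (fs i) fz     f | inj₂ (e , _) = Adj-sym (subst (Adj G z) (sym (path-lookup-last q i e)) zy)
      adjacent (fs i) (fs j) f | inj₂ (_ , ())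

    cycle-chordless : (∀ t → t ∈ xs → Adj G z t → t ≡ x ⊎ t ≡ y) → Chordless G cycle
    cycle-chordless zt fz     fz     a = ⊥-elim (Adj-irrefl a)
    cycle-chordless zt fz     (fs j) a with zt (lookup xs j) (∈-lookup j) a
    ... | inj₁ e = inj₁ (follows-suc fz (fs j) (cong suc (path-lookup≡head q j e)))
    ... | inj₂ e = inj₂ (follows-wrap (fs j) fz (path-lookup≡last q j e) refl)
    cycle-chordless zt (fs i) fz     a with zt (lookup xs i) (∈-lookup i) (Adj-sym a)
    ... | inj₁ e = inj₂ (follows-suc fz (fs i) (cong suc (path-lookup≡head q i e)))
    ... | inj₂ e = inj₁ (follows-wrap (fs i) fz (path-lookup≡last q i e) refl)
    cycle-chordless zt (fs i) (fs j) a with path-adj⇒consecutive q i j a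
    ... | inj₁ e = inj₁ (follows-suc (fs i) (fs j) (cong suc e))
    ... | inj₂ e = inj₂ (follows-suc (fs j) (fs i) (cong suc e))

    cycle-contains-zy : CycleContainsEdge cycle z y
    cycle-contains-zy with path-last-index q
    ... | i , e = fs i , fz , follows-wrap (fs i) fz e refl , inj₂ (path-lookup-last q i e , refl)

  module OnCycle {m} (c : Fin (suc m) → Fin n) (cy : IsCycle G c) where

    at : (k : ℕ) → .(k < suc m) → Fin n
    at k p = c (fromℕ< p)

    c-injective : Injective _≡_ _≡_ c
    c-injective = proj₁ (proj₂ cy)

    c-adj : ∀ {i j} → Follows i j → Adj G (c i) (c j)
    c-adj {i} {j} = proj₂ (proj₂ cy) i j

    at-adj-suc : ∀ k .(p : k < suc m) .(p′ : suc k < suc m) → Adj G (at k p) (at (suc k) p′)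
    at-adj-suc k p p′ = c-adj (follows-suc (fromℕ< p) (fromℕ< p′)
                                 (trans (toℕ-fromℕ< p′) (cong suc (sym (toℕ-fromℕ< p)))))

    at-adj-wrap : .(p : m < suc m) .(p′ : 0 < suc m) → Adj G (at m p) (at 0 p′)
    at-adj-wrap p p′ = c-adj (follows-wrap (fromℕ< p) (fromℕ< p′) (toℕ-fromℕ< p) (toℕ-fromℕ< p′))

    c≡at : ∀ x k (kp : k < suc m) → toℕ x ≡ k → c x ≡ at k kp
    c≡at x k kp e = cong c (toℕ-injective (trans e (sym (toℕ-fromℕ< kp))))

    at≢c : ∀ k (kp : k < suc m) x → k ≢ toℕ x → at k kp ≢ c x
    at≢c k kp x k≢x e = k≢x (trans (sym (toℕ-fromℕ< kp)) (cong toℕ (c-injective e)))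

    walk-along : ∀ {Q : Fin n → Set} a b (a≤b : a ≤ b) (bp : b < suc m) →
                 (∀ k (kp : k < suc m) → a ≤ k → k ≤ b → Q (at k kp)) →
                 WalkIn G Q (at a (≤-<-trans a≤b bp)) (at b bp)
    walk-along zero zero    z≤n bp hyp = here (hyp 0 bp z≤n z≤n)
    walk-along a    (suc b) a≤b bp hyp with m≤n⇒m<n∨m≡n a≤b
    ... | inj₂ refl      = here (hyp (suc b) bp a≤b ≤-refl)
    ... | inj₁ (s≤s a≤b′) =
      walk-snoc (walk-along a b a≤b′ b<m (λ k kp ak kb → hyp k kp ak (m≤n⇒m≤1+n kb)))
                (at-adj-suc b b<m bp) (hyp (suc b) bp a≤b ≤-refl)
      where
      b<m : b < suc m
      b<m = <-trans (n<1+n b) bp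

    cycle-detour : ∀ i j → Follows i j →
                   Σ (Fin n) λ w → Adj G (c j) w × w ≢ c i × WalkIn G (λ x → x ≢ c j) w (c i)
    cycle-detour i j f with follows-cases i j f
    ... | inj₁ e with m≤n⇒m<n∨m≡n (≤-pred (toℕ<n j))
    ...   | inj₁ j<m =
            at (suc (toℕ j)) (s≤s j<m)
          , Adj-resp (sym (c≡at j (toℕ j) (toℕ<n j) refl)) refl (at-adj-suc (toℕ j) (toℕ<n j) (s≤s j<m))
          , at≢c _ (s≤s j<m) i (λ e′ → <⇒≢ (s≤s (subst (toℕ i ≤_) (sym e) (m≤n⇒m≤1+n ≤-refl))) (sym e′))
          , subst (WalkIn G _ _) (sym (c≡at i _ (toℕ<n i) refl))
              (walk-++ (walk-along (suc (toℕ j)) m j<m (n<1+n m) after-j)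
                       (step (at≢c m (n<1+n m) j (λ e′ → <⇒≢ j<m (sym e′))) (at-adj-wrap (n<1+n m) (s≤s z≤n))
                             (walk-along 0 (toℕ i) z≤n (toℕ<n i) up-to-i)))
      where
      after-j : ∀ k (kp : k < suc m) → suc (toℕ j) ≤ k → k ≤ m → at k kp ≢ c j
      after-j k kp jk _ = at≢c k kp j (λ e′ → <⇒≢ jk (sym e′))
      up-to-i : ∀ k (kp : k < suc m) → 0 ≤ k → k ≤ toℕ i → at k kp ≢ c j
      up-to-i k kp _ ki = at≢c k kp j (λ e′ → <⇒≢ (subst (k <_) (sym e) (s≤s ki)) e′)
    ...   | inj₂ j≡m =
            at 0 (s≤s z≤n)
          , Adj-resp (sym (c≡at j m (n<1+n m) j≡m)) refl (at-adj-wrap (n<1+n m) (s≤s z≤n))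
          , at≢c 0 (s≤s z≤n) i (λ e′ → <⇒≢ (proj₁ cy) (sym (trans (sym j≡m) (trans e (cong suc (sym e′))))))
          , subst (WalkIn G _ _) (sym (c≡at i _ (toℕ<n i) refl)) (walk-along 0 (toℕ i) z≤n (toℕ<n i) up-to-i)
      where
      up-to-i : ∀ k (kp : k < suc m) → 0 ≤ k → k ≤ toℕ i → at k kp ≢ c j
      up-to-i k kp _ ki = at≢c k kp j (λ e′ → <⇒≢ (subst (k <_) (sym e) (s≤s ki)) e′)
    cycle-detour i j f | inj₂ (i≡m , j≡0) =
            at 1 1<m
          , Adj-resp (sym (c≡at j 0 (s≤s z≤n) j≡0)) refl (at-adj-suc 0 (s≤s z≤n) 1<m)
          , at≢c 1 1<m i (λ e′ → <⇒≢ (proj₁ cy) (trans e′ i≡m))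
          , subst (WalkIn G _ _) (sym (c≡at i m (n<1+n m) i≡m))
              (walk-along 1 m (≤-trans (s≤s z≤n) (proj₁ cy)) (n<1+n m) from-1)
      where
      1<m : 1 < suc m
      1<m = s≤s (≤-trans (s≤s z≤n) (proj₁ cy))
      from-1 : ∀ k (kp : k < suc m) → 1 ≤ k → k ≤ m → at k kp ≢ c j
      from-1 k kp 1≤k _ = at≢c k kp j (λ e′ → <⇒≢ 1≤k (sym (trans e′ j≡0)))

  path-from-last-neighbour≢ :
    ∀ {P w u xs} v → InducedPath P w u xs → Any (λ s → s ≢ u × Adj G v s) xs →
    Σ (Fin n) λ t → Σ (List (Fin n)) λ ys → InducedPath P t u (t ∷ ys) × Adj G v t × t ≢ u ×
      All (λ s → s ≢ u → ¬ Adj G v s) ys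
  path-from-last-neighbour≢ v (single p) (here (ne , a)) = ⊥-elim (ne refl)
  path-from-last-neighbour≢ {u = u} v (cons {w = w} {xs = xs} p a q u∉ na) an
    with Any.any? (λ s → ¬? (s ≟ u) ×-dec adj? v s) (w ∷ xs)
  ... | yes an′ = path-from-last-neighbour≢ v q an′
  path-from-last-neighbour≢ v (cons {w = w} {xs = xs} p a q u∉ na) (here (ne , a′)) | no ¬an =
    _ , _ , cons p a q u∉ na , a′ , ne , All.map (λ h ne′ a″ → h (ne′ , a″)) (¬Any⇒All¬ (w ∷ xs) ¬an)
  path-from-last-neighbour≢ v (cons p a q u∉ na) (there an) | no ¬an = ⊥-elim (¬an an)

  -- Shortcut the detour to an induced path from the last neighbour t ≠ u of v;
  -- if t is not adjacent to u, closing this path by v is a chordless cycle of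
  -- length ≥ 4.
  chordal-detour⇒triangle : Chordal G → ∀ {u v w} → Adj G u v → Adj G v w → w ≢ u →
                            WalkIn G (λ x → x ≢ v) w u → Σ (Fin n) λ t → Adj G u t × Adj G v t
  chordal-detour⇒triangle ch {u} {v} {w} uv vw w≢u W with walk⇒path W
  ... | xs , q with path-from-last-neighbour≢ v q (Any.map (λ { refl → w≢u , vw }) (path-head∈ q))
  ...   | t , ys , single _ , vt , t≢u , _ = ⊥-elim (t≢u refl)
  ...   | t , ys , cons _ a (single _) _ _ , vt , _ , _ = t , Adj-sym a , vt
  ...   | t , ys , r@(cons _ _ (cons _ _ _ _ _) _ _) , vt , t≢u , na =
          ⊥-elim (ch _ cycle (s≤s (s≤s (s≤s z≤n))) cycle-isCycle (cycle-chordless only-ends))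
    where
    v∉ : v ∉ (t ∷ ys)
    v∉ mem = All.lookup (path-all r) mem refl
    open Closing v r v∉ vt (Adj-sym uv) (path-length≥2 r t≢u)
    only-ends : ∀ s → s ∈ (t ∷ ys) → Adj G v s → s ≡ t ⊎ s ≡ u
    only-ends s (here e)    _ = inj₁ e
    only-ends s (there mem) a with s ≟ u
    ... | yes e = inj₂ e
    ... | no ne = ⊥-elim (All.lookup na mem ne a)

  chordal-cycle-edge⇒triangle : Chordal G → ∀ {m} (c : Fin (suc m) → Fin n) → IsCycle G c →
                                ∀ {u v} → Adj G u v → CycleContainsEdge c u v →
                                Σ (Fin n) λ w → Adj G u w × Adj G v w
  chordal-cycle-edge⇒triangle ch c cy uv (i , j , f , inj₁ (refl , refl)) =
    let w , jw , w≢i , W = OnCycle.cycle-detour c cy i j f in chordal-detour⇒triangle ch uv jw w≢i W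
  chordal-cycle-edge⇒triangle ch c cy uv (i , j , f , inj₂ (refl , refl)) =
    let w , jw , w≢i , W = OnCycle.cycle-detour c cy i j f
        t , it , jt = chordal-detour⇒triangle ch (Adj-sym uv) jw w≢i W
    in t , jt , it

  bridgeless-chordal⇒triangle : Bridgeless G → Chordal G → ∀ {u v} → Adj G u v →
                                Σ (Fin n) λ w → Adj G u w × Adj G v w
  bridgeless-chordal⇒triangle bl ch {u} {v} uv with any? (λ w → adj? u w ×-dec adj? v w)
  ... | yes t  = t
  ... | no ¬t = ⊥-elim (bl u v (uv , λ (_ , c , cy , ce) → ¬t (chordal-cycle-edge⇒triangle ch c cy uv ce)))

  triangle⇒¬bridge : ∀ {u v w} → Adj G u v → Adj G u w → Adj G v w → ¬ IsBridge G u v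
  triangle⇒¬bridge {u} {v} {w} uv uw vw (_ , no-cycle) =
    no-cycle (2 , cycle , cycle-isCycle , cycle-contains-zy)
    where
    wv-path : InducedPath (λ _ → ⊤) w v (w ∷ v ∷ [])
    wv-path = cons tt (Adj-sym vw) (single tt) (λ { (here w≡v) → Adj⇒≢ vw (sym w≡v) }) []
    u∉ : u ∉ (w ∷ v ∷ [])
    u∉ (here u≡w)         = Adj⇒≢ uw u≡w
    u∉ (there (here u≡v)) = Adj⇒≢ uv u≡v
    open Closing u wv-path u∉ uw uv (s≤s (s≤s z≤n))

record Enumeration {n} (P : Fin n → Set) : Set where
  field
    size           : ℕ
    elem           : Fin size → Fin n
    elem-injective : Injective _≡_ _≡_ elem
    elem-sat       : ∀ i → P (elem i)
    elem-onto      : ∀ v → P v → InImage elem v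
    size<n         : ∀ v → ¬ P v → size < n
    2≤size         : ∀ x y → P x → P y → x ≢ y → 2 ≤ size

2≤length : ∀ {n} (xs : List (Fin n)) {x y} → x ∈ xs → y ∈ xs → x ≢ y → 2 ≤ length xs
2≤length (_ ∷ [])    (here refl) (here refl) x≢y = ⊥-elim (x≢y refl)
2≤length (_ ∷ _ ∷ _) _           _           _   = s≤s (s≤s z≤n)

enumerate : ∀ {n} {P : Fin n → Set} → Decidable P → Enumeration P
enumerate {n} {P} P? = record
  { size           = length xs
  ; elem           = lookup xs
  ; elem-injective = lookup-injective xs-unique
  ; elem-sat       = λ i → proj₂ (∈-filter⁻ P? {xs = allFin n} (∈-lookup i))
  ; elem-onto      = λ v pv → Any.index (∈xs pv) , sym (lookup-index (∈xs pv))
  ; size<n         = λ v ¬pv →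
      unique-length≤ {xs = v ∷ xs} (¬Any⇒All¬ xs (¬pv ∘ proj₂ ∘ ∈-filter⁻ P? {xs = allFin n}) ∷ xs-unique)
  ; 2≤size         = λ x y px py → 2≤length xs (∈xs px) (∈xs py)
  }
  where
  xs : List (Fin n)
  xs = filter P? (allFin n)
  xs-unique : Unique xs
  xs-unique = filter⁺ P? (allFin⁺ n)
  ∈xs : ∀ {v} → P v → v ∈ xs
  ∈xs pv = ∈-filter⁺ P? (∈-allFin _) pv

record Embedding {a b} (H : Graph a) (G : Graph b) : Set where
  field
    embed           : Fin a → Fin b
    embed-injective : Injective _≡_ _≡_ embed
    embed-adj       : ∀ i j → Graph.adj H i j ≡ Graph.adj G (embed i) (embed j)

induced : ∀ {n} (G : Graph n) {P : Fin n → Set} (E : Enumeration P) → Graph (Enumeration.size E)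
induced G E = record { adj        = λ i j → Graph.adj G (elem i) (elem j)
                     ; adj-sym    = λ i j → Graph.adj-sym G (elem i) (elem j)
                     ; adj-irrefl = λ i → Graph.adj-irrefl G (elem i) }
  where open Enumeration E

induced-embedding : ∀ {n} (G : Graph n) {P : Fin n → Set} (E : Enumeration P) → Embedding (induced G E) G
induced-embedding G E = record { embed = Enumeration.elem E ; embed-injective = Enumeration.elem-injective E
                               ; embed-adj = λ _ _ → refl }

module EmbeddingProps {a b} {H : Graph a} {G : Graph b} (M : Embedding H G) where
  open Embedding M

  Adj-embed : ∀ {i j} → Adj H i j → Adj G (embed i) (embed j)
  Adj-embed {i} {j} = subst T (embed-adj i j)

  Adj-unembed : ∀ {i j} → Adj G (embed i) (embed j) → Adj H i j
  Adj-unembed {i} {j} = subst T (sym (embed-adj i j))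

  walk-embed : ∀ {P Q} {i j} → (∀ {x} → P x → Q (embed x)) → WalkIn H P i j → WalkIn G Q (embed i) (embed j)
  walk-embed f (here p)     = here (f p)
  walk-embed f (step p a w) = step (f p) (Adj-embed a) (walk-embed f w)

  walk-unembed : ∀ {Q : Fin b → Set} → (∀ {x} → Q x → InImage embed x) →
                 ∀ {u v} → WalkIn G Q u v → ∀ i j → embed i ≡ u → embed j ≡ v → WalkIn H (Q ∘ embed) i j
  walk-unembed img (here q) i j refl ej with embed-injective ej
  ... | refl = here q
  walk-unembed img (step q a w) i j refl ej with img (Props.walk-head G w)
  ... | i′ , refl = step q (Adj-unembed a) (walk-unembed img w i′ j refl ej)

  isCycle-embed : ∀ {m} {c : Fin (suc m) → Fin a} → IsCycle H c → IsCycle G (embed ∘ c)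
  isCycle-embed (2≤m , c-inj , c-adj) = 2≤m , c-inj ∘ embed-injective , λ i j f → Adj-embed (c-adj i j f)

  contains-embed : ∀ {m} {c : Fin (suc m) → Fin a} {u v} → CycleContainsEdge c u v →
                   CycleContainsEdge (embed ∘ c) (embed u) (embed v)
  contains-embed (i , j , f , inj₁ (p , q)) = i , j , f , inj₁ (cong embed p , cong embed q)
  contains-embed (i , j , f , inj₂ (p , q)) = i , j , f , inj₂ (cong embed p , cong embed q)

  ¬bridge-embed : Bridgeless H → ∀ i j → ¬ IsBridge G (embed i) (embed j)
  ¬bridge-embed bl i j (ij , no-cycle) =
    bl i j (Adj-unembed ij , λ (m , c , cy , ce) → no-cycle (m , embed ∘ c , isCycle-embed cy , contains-embed ce))

  chordal-unembed : Chordal G → Chordal H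
  chordal-unembed ch m c 3≤m cy chl =
    ch m (embed ∘ c) 3≤m (isCycle-embed cy) (λ i j a → chl i j (Adj-unembed a))

  module CycleUnembed {m} (c : Fin (suc m) → Fin b) (cy : IsCycle G c) (pre : ∀ i → InImage embed (c i)) where

    c′ : Fin (suc m) → Fin a
    c′ i = proj₁ (pre i)

    embed-c′ : ∀ i → embed (c′ i) ≡ c i
    embed-c′ i = proj₂ (pre i)

    c′-isCycle : IsCycle H c′
    c′-isCycle = proj₁ cy
               , (λ {i} {j} eq → proj₁ (proj₂ cy) (trans (sym (embed-c′ i)) (trans (cong embed eq) (embed-c′ j))))
               , λ i j f → Adj-unembed (Props.Adj-resp G (sym (embed-c′ i)) (sym (embed-c′ j)) (proj₂ (proj₂ cy) i j f))

    c′-chordless : Chordless G c → Chordless H c′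
    c′-chordless chl i j a = chl i j (Props.Adj-resp G (embed-c′ i) (embed-c′ j) (Adj-embed a))

    c′-unembed : ∀ {i w} → c i ≡ embed w → c′ i ≡ w
    c′-unembed {i} p = embed-injective (trans (embed-c′ i) p)

    c′-contains : ∀ {u v} → CycleContainsEdge c (embed u) (embed v) → CycleContainsEdge c′ u v
    c′-contains (i , j , f , inj₁ (p , q)) = i , j , f , inj₁ (c′-unembed p , c′-unembed q)
    c′-contains (i , j , f , inj₂ (p , q)) = i , j , f , inj₂ (c′-unembed p , c′-unembed q)

  ¬bridge-unembed : ∀ {m} (c : Fin (suc m) → Fin b) → IsCycle G c → (∀ i → InImage embed (c i)) →
                    ∀ {u v} → CycleContainsEdge c (embed u) (embed v) → ¬ IsBridge H u v
  ¬bridge-unembed {m} c cy pre ce (_ , no-cycle) = no-cycle (m , c′ , c′-isCycle , c′-contains ce)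
    where open CycleUnembed c cy pre

  minor-embed : ∀ {m} {K′ : Graph m} → HasMinor K′ H → HasMinor K′ G
  minor-embed {m} {K′} (β , nonempty , connected , adjacent) = β′ , nonempty′ , connected′ , adjacent′
    where
    β′ : Fin b → Maybe (Fin m)
    β′ v with any? (λ i → embed i ≟ v)
    ... | yes (i , _) = β i
    ... | no _        = nothing

    β′-embed : ∀ i → β′ (embed i) ≡ β i
    β′-embed i with any? (λ k → embed k ≟ embed i)
    ... | yes (k , ek) = cong β (embed-injective ek)
    ... | no ¬k        = ⊥-elim (¬k (i , refl))

    β′-image : ∀ v {x} → β′ v ≡ just x → InImage embed v
    β′-image v eq with any? (λ k → embed k ≟ v)
    β′-image v eq  | yes r = r
    β′-image v ()  | no _

    nonempty′ : ∀ x → ∃ λ v → β′ v ≡ just x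
    nonempty′ x = let v , eq = nonempty x in embed v , trans (β′-embed v) eq

    connected′ : ∀ x u v → β′ u ≡ just x → β′ v ≡ just x → WalkIn G (λ w → β′ w ≡ just x) u v
    connected′ x u v pu pv with β′-image u pu | β′-image v pv
    ... | i , refl | j , refl =
      walk-embed (λ {y} q → trans (β′-embed y) q)
        (connected x i j (trans (sym (β′-embed i)) pu) (trans (sym (β′-embed j)) pv))

    adjacent′ : ∀ x y → Adj K′ x y → ∃ λ u → ∃ λ v → β′ u ≡ just x × β′ v ≡ just y × Adj G u v
    adjacent′ x y a = let u , v , pu , pv , uv = adjacent x y a in
      embed u , embed v , trans (β′-embed u) pu , trans (β′-embed v) pv , Adj-embed uv

-- Clique sums

-- A walk that leaves In exits and re-enters through the clique Bd, so each
-- excursion can be replaced by a single edge of Bd.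
module Reroute {n} (G : Graph n) {In : Fin n → Set} (In? : Decidable In) {Bd : Fin n → Set}
  (exit : ∀ {x y} → In x → ¬ In y → Adj G x y → Bd x)
  (Bd-clique : ∀ {x y} → Bd x → Bd y → x ≢ y → Adj G x y) where
  open Props G

  reroute : ∀ {Q u v} → WalkIn G Q u v → In u → In v → WalkIn G (λ x → Q x × In x) u v
  excursion : ∀ {Q s w v} → Q s → In s → Bd s → WalkIn G Q w v → ¬ In w → In v →
              WalkIn G (λ x → Q x × In x) s v
  reroute (here q) iu iv = here (q , iu)
  reroute (step {w = w} q a W) iu iv with In? w
  ... | yes iw  = step (q , iu) a (reroute W iw iv)
  ... | no ¬iw = excursion q iu (exit iu ¬iw a) W ¬iw iv
  excursion qs is bs (here _) ¬iw iv = ⊥-elim (¬iw iv)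
  excursion {s = s} qs is bs (step {w = w′} qw a W) ¬iw iv with In? w′
  ... | no ¬iw′ = excursion qs is bs W ¬iw′ iv
  ... | yes iw′ with s ≟ w′
  ...   | yes refl = reroute W iw′ iv
  ...   | no s≢w′  = step (qs , is) (Bd-clique bs (exit iw′ ¬iw (Adj-sym a)) s≢w′) (reroute W iw′ iv)

cliqueSum-swap : ∀ {n₁ n₂ n} {G₁ : Graph n₁} {G₂ : Graph n₂} {G : Graph n} {k} →
                 CliqueSum G₁ G₂ G k → CliqueSum G₂ G₁ G k
cliqueSum-swap cs = record
  { f₁ = f₂ ; f₂ = f₁ ; f₁-inj = f₂-inj ; f₂-inj = f₁-inj ; f₁-adj = f₂-adj ; f₂-adj = f₁-adj
  ; cover   = swap ∘ cover
  ; edges   = λ u v a → swap (edges u v a)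
  ; g       = g ; g-inj = g-inj
  ; g-inter = λ v (i₁ , i₂) → g-inter v (i₂ , i₁)
  ; inter-g = λ t → proj₂ (inter-g t) , proj₁ (inter-g t)
  ; clique  = clique }
  where open CliqueSum cs

module CliqueSumProps {n₁ n₂ n} {G₁ : Graph n₁} {G₂ : Graph n₂} {G : Graph n} {k : ℕ}
                      (cs : CliqueSum G₁ G₂ G k) where
  open CliqueSum cs

  embedding₁ : Embedding G₁ G
  embedding₁ = record { embed = f₁ ; embed-injective = f₁-inj ; embed-adj = f₁-adj }

  embedding₂ : Embedding G₂ G
  embedding₂ = record { embed = f₂ ; embed-injective = f₂-inj ; embed-adj = f₂-adj }

  in₁? : Decidable (InImage f₁)
  in₁? v = any? (λ i → f₁ i ≟ v)

  in₂? : Decidable (InImage f₂)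
  in₂? v = any? (λ i → f₂ i ≟ v)

  Separator : Fin n → Set
  Separator = InImage g

  exit₁ : ∀ {x y} → InImage f₁ x → ¬ InImage f₁ y → Adj G x y → Separator x
  exit₁ {x} {y} ix ¬iy a with edges x y a
  ... | inj₁ (_ , iy)   = ⊥-elim (¬iy iy)
  ... | inj₂ (ix₂ , _) = g-inter x (ix , ix₂)

  separator-clique : ∀ {x y} → Separator x → Separator y → x ≢ y → Adj G x y
  separator-clique (s , refl) (t , refl) x≢y = clique s t (x≢y ∘ cong g)

  ¬Adj-outside : ∀ {x y} → ¬ InImage f₁ x → ¬ InImage f₂ y → ¬ Adj G x y
  ¬Adj-outside {x} {y} ¬ix ¬iy a with edges x y a
  ... | inj₁ (ix , _) = ¬ix ix
  ... | inj₂ (_ , iy) = ¬iy iy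

  in₁-and-in₂⇒separator : ∀ {x} → InImage f₁ x → InImage f₂ x → Separator x
  in₁-and-in₂⇒separator i₁ i₂ = g-inter _ (i₁ , i₂)

  ¬in₁⇒in₂ : ∀ {x} → ¬ InImage f₁ x → InImage f₂ x
  ¬in₁⇒in₂ {x} ¬i₁ with cover x
  ... | inj₁ i₁ = ⊥-elim (¬i₁ i₁)
  ... | inj₂ i₂ = i₂

bridgeless-cliqueSum : ∀ {n₁ n₂ n} {G₁ : Graph n₁} {G₂ : Graph n₂} {G : Graph n} {k} →
                       CliqueSum G₁ G₂ G k → Bridgeless G₁ → Bridgeless G₂ → Bridgeless G
bridgeless-cliqueSum cs bl₁ bl₂ u v (uv , no-cycle) with CliqueSum.edges cs u v uv
... | inj₁ ((i , refl) , (j , refl)) = EmbeddingProps.¬bridge-embed (CliqueSumProps.embedding₁ cs) bl₁ i j (uv , no-cycle)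
... | inj₂ ((i , refl) , (j , refl)) = EmbeddingProps.¬bridge-embed (CliqueSumProps.embedding₂ cs) bl₂ i j (uv , no-cycle)

-- On a chordless cycle, two vertices of a clique S must be consecutive.  If
-- the cycle has a vertex outside G₁ before one outside G₂, it meets the
-- separator strictly between them and again outside that stretch.
module ChordlessCycleCrossing {n} (G : Graph n) {m} (c : Fin (suc m) → Fin n) (cy : IsCycle G c)
  (chl : Chordless G c) (S : Fin n → Set) (S-clique : ∀ {x y} → S x → S y → x ≢ y → Adj G x y) where
  open Props G
  open OnCycle c cy

  module Sides (X Y : Fin n → Set) (trichotomy : ∀ v → X v ⊎ Y v ⊎ S v)
               (X-Y : ∀ {x y} → X x → Y y → ¬ Adj G x y) where

    S-between : ∀ a b (a<b : a < b) (bp : b < suc m) → X (at a (<-trans a<b bp)) → Y (at b bp) →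
                Σ ℕ λ p → a < p × p < b × Σ (p < suc m) λ pp → S (at p pp)
    S-between a (suc b) a<b bp xa yb with m≤n⇒m<n∨m≡n (≤-pred a<b)
    ... | inj₂ refl = ⊥-elim (X-Y xa yb (at-adj-suc a _ bp))
    ... | inj₁ a<b′ with trichotomy (at b (<-trans (n<1+n b) bp))
    ...   | inj₁ xb        = ⊥-elim (X-Y xb yb (at-adj-suc b _ bp))
    ...   | inj₂ (inj₂ sb) = b , a<b′ , n<1+n b , <-trans (n<1+n b) bp , sb
    ...   | inj₂ (inj₁ yb′) with S-between a b a<b′ (<-trans (n<1+n b) bp) xa yb′
    ...     | p , ap , pb , pp , sp = p , ap , <-trans pb (n<1+n b) , pp , sp

    S-after-or-Y : ∀ a b (a≤b : a ≤ b) (bp : b < suc m) → Y (at a (≤-<-trans a≤b bp)) →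
                   (Σ ℕ λ q → a < q × q ≤ b × Σ (q < suc m) λ qp → S (at q qp)) ⊎ Y (at b bp)
    S-after-or-Y a zero    z≤n bp ya = inj₂ ya
    S-after-or-Y a (suc b) a≤b bp ya with m≤n⇒m<n∨m≡n a≤b
    ... | inj₂ refl = inj₂ ya
    ... | inj₁ (s≤s a≤b′) with S-after-or-Y a b a≤b′ (<-trans (n<1+n b) bp) ya
    ...   | inj₁ (q , aq , qb , qp , sq) = inj₁ (q , aq , m≤n⇒m≤1+n qb , qp , sq)
    ...   | inj₂ yb with trichotomy (at (suc b) bp)
    ...     | inj₁ xb        = ⊥-elim (X-Y xb yb (Adj-sym (at-adj-suc b _ bp)))
    ...     | inj₂ (inj₁ yb′) = inj₂ yb′
    ...     | inj₂ (inj₂ sb)  = inj₁ (suc b , s≤s a≤b′ , ≤-refl , bp , sb)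

  ¬follows-across : ∀ A p B q (pp : p < suc m) (qp : q < suc m) → A < p → p < B → B ≤ m → (B < q ⊎ q < A) →
                    ¬ Follows (fromℕ< pp) (fromℕ< qp) × ¬ Follows (fromℕ< qp) (fromℕ< pp)
  ¬follows-across A p B q pp qp A<p p<B B≤m side = p→q side , q→p side
    where
    toℕp : toℕ (fromℕ< pp) ≡ p
    toℕp = toℕ-fromℕ< pp
    toℕq : toℕ (fromℕ< qp) ≡ q
    toℕq = toℕ-fromℕ< qp
    p→q : (B < q ⊎ q < A) → ¬ Follows (fromℕ< pp) (fromℕ< qp)
    p→q sd f with follows-cases (fromℕ< pp) (fromℕ< qp) f | sd
    ... | inj₁ e       | inj₁ B<q =
      <-irrefl refl (<-≤-trans B<q (subst (_≤ B) (sym (trans (sym toℕq) (trans e (cong suc toℕp)))) p<B))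
    ... | inj₁ e       | inj₂ q<A =
      <-irrefl refl (<-trans A<p (<-trans (subst (p <_) (sym (trans (sym toℕq) (trans e (cong suc toℕp)))) (n<1+n p)) q<A))
    ... | inj₂ (e , _) | _        = <-irrefl refl (<-≤-trans (subst (_< B) (trans (sym toℕp) e) p<B) B≤m)
    q→p : (B < q ⊎ q < A) → ¬ Follows (fromℕ< qp) (fromℕ< pp)
    q→p sd f with follows-cases (fromℕ< qp) (fromℕ< pp) f | sd
    ... | inj₁ e       | inj₁ B<q =
      <-irrefl refl (<-trans B<q (<-trans (subst (q <_) (sym (trans (sym toℕp) (trans e (cong suc toℕq)))) (n<1+n q)) p<B))
    ... | inj₁ e       | inj₂ q<A =
      <-irrefl refl (<-≤-trans A<p (subst (_≤ A) (sym (trans (sym toℕp) (trans e (cong suc toℕq)))) q<A))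
    ... | inj₂ (_ , e) | _        = n≮0 (subst (A <_) (trans (sym toℕp) e) A<p)

  at-across-≢ : ∀ A B p q (pp : p < suc m) (qp : q < suc m) → A < p → p < B → (B < q ⊎ q < A) → at p pp ≢ at q qp
  at-across-≢ A B p q pp qp A<p p<B side e
    with trans (sym (toℕ-fromℕ< pp)) (trans (cong toℕ (c-injective e)) (toℕ-fromℕ< qp)) | side
  ... | refl | inj₁ B<q = <-irrefl refl (<-trans p<B B<q)
  ... | refl | inj₂ q<A = <-irrefl refl (<-trans A<p q<A)

  S-across-absurd : ∀ A B p q (pp : p < suc m) (qp : q < suc m) → S (at p pp) → S (at q qp) →
                    A < p → p < B → B ≤ m → (B < q ⊎ q < A) → ⊥
  S-across-absurd A B p q pp qp sp sq A<p p<B B≤m side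
    with ¬follows-across A p B q pp qp A<p p<B B≤m side
       | chl (fromℕ< pp) (fromℕ< qp) (S-clique sp sq (at-across-≢ A B p q pp qp A<p p<B side))
  ... | ¬p→q , _    | inj₁ f = ¬p→q f
  ... | _    , ¬q→p | inj₂ f = ¬q→p f

  module Crossing (X Y : Fin n → Set) (trichotomy : ∀ v → X v ⊎ Y v ⊎ S v)
                  (X-Y : ∀ {x y} → X x → Y y → ¬ Adj G x y)
                  (X⇒¬S : ∀ {x} → X x → ¬ S x) (X⇒¬Y : ∀ {x} → X x → ¬ Y x) where
    open Sides X Y trichotomy X-Y

    trichotomy-swap : ∀ v → Y v ⊎ X v ⊎ S v
    trichotomy-swap v with trichotomy v
    ... | inj₁ x        = inj₂ (inj₁ x)
    ... | inj₂ (inj₁ y) = inj₁ y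
    ... | inj₂ (inj₂ s) = inj₂ (inj₂ s)

    module Swapped = Sides Y X trichotomy-swap (λ y x a → X-Y x y (Adj-sym a))

    0<A : ∀ A (ap : A < suc m) → X (at A ap) → ¬ X (at 0 (s≤s z≤n)) → 0 < A
    0<A zero    _ xA ¬x₀ = ⊥-elim (¬x₀ xA)
    0<A (suc A) _ _  _   = s≤s z≤n

    no-crossing : ∀ A B (ap : A < suc m) (bp : B < suc m) → A < B → X (at A ap) → Y (at B bp) → ⊥
    no-crossing A B ap bp A<B xA yB with S-between A B A<B bp xA yB
    ... | p , A<p , p<B , pp , sp with S-after-or-Y B m (≤-pred bp) (n<1+n m) yB
    ...   | inj₁ (q , B<q , _ , qp , sq) = S-across-absurd A B p q pp qp sp sq A<p p<B (≤-pred bp) (inj₁ B<q)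
    ...   | inj₂ yₘ with trichotomy (at 0 (s≤s z≤n))
    ...     | inj₁ x₀        = X-Y x₀ yₘ (Adj-sym (at-adj-wrap (n<1+n m) (s≤s z≤n)))
    ...     | inj₂ (inj₂ s₀) =
      S-across-absurd A B p 0 pp (s≤s z≤n) sp s₀ A<p p<B (≤-pred bp) (inj₂ (0<A A ap xA (λ x → X⇒¬S x s₀)))
    ...     | inj₂ (inj₁ y₀) with Swapped.S-between 0 A (0<A A ap xA (λ x → X⇒¬Y x y₀)) ap y₀ xA
    ...       | q , _ , q<A , qp , sq = S-across-absurd A B p q pp qp sp sq A<p p<B (≤-pred bp) (inj₂ q<A)

chordal-cliqueSum : ∀ {n₁ n₂ n} {G₁ : Graph n₁} {G₂ : Graph n₂} {G : Graph n} {k} →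
                    CliqueSum G₁ G₂ G k → Chordal G₁ → Chordal G₂ → Chordal G
chordal-cliqueSum {n = n} {G₁} {G₂} {G} cs ch₁ ch₂ m c 3≤m cy chl
  with all? (λ i → in₁? (c i)) | all? (λ i → in₂? (c i))
  where open CliqueSumProps cs
... | yes all₁ | _ = ch₁ m c′ 3≤m c′-isCycle (c′-chordless chl)
  where open EmbeddingProps.CycleUnembed (CliqueSumProps.embedding₁ cs) c cy all₁
... | _ | yes all₂ = ch₂ m c′ 3≤m c′-isCycle (c′-chordless chl)
  where open EmbeddingProps.CycleUnembed (CliqueSumProps.embedding₂ cs) c cy all₂
... | no ¬all₁ | no ¬all₂
  with ¬∀⟶∃¬ _ _ (λ i → CliqueSumProps.in₁? cs (c i)) ¬all₁ | ¬∀⟶∃¬ _ _ (λ i → CliqueSumProps.in₂? cs (c i)) ¬all₂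
...   | i , ¬in₁ | j , ¬in₂ = crossing
  where
  open CliqueSum cs using (f₁; f₂; cover; inter-g)
  open CliqueSumProps cs
  open ChordlessCycleCrossing G c cy chl Separator separator-clique
  open Props.OnCycle G c cy using (c≡at)
  X Y : Fin n → Set
  X v = ¬ InImage f₁ v
  Y v = ¬ InImage f₂ v
  trichotomy : ∀ v → X v ⊎ Y v ⊎ Separator v
  trichotomy v with in₁? v | in₂? v
  ... | no x  | _     = inj₁ x
  ... | yes _ | no y  = inj₂ (inj₁ y)
  ... | yes a | yes b = inj₂ (inj₂ (in₁-and-in₂⇒separator a b))
  X⇒¬S : ∀ {x} → X x → ¬ Separator x
  X⇒¬S x (t , refl) = x (proj₁ (inter-g t))
  Y⇒¬S : ∀ {x} → Y x → ¬ Separator x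
  Y⇒¬S y (t , refl) = y (proj₂ (inter-g t))
  X⇒¬Y : ∀ {x} → X x → ¬ Y x
  X⇒¬Y x y = y (¬in₁⇒in₂ x)
  module XY = Crossing X Y trichotomy ¬Adj-outside X⇒¬S X⇒¬Y
  module YX = Crossing Y X XY.trichotomy-swap (λ y x a → ¬Adj-outside x y (Props.Adj-sym G a)) Y⇒¬S (λ y x → X⇒¬Y x y)
  crossing : ⊥
  crossing with <-cmp (toℕ i) (toℕ j)
  ... | tri< i<j _ _ = XY.no-crossing (toℕ i) (toℕ j) (toℕ<n i) (toℕ<n j) i<j
                         (subst X (c≡at i _ (toℕ<n i) refl) ¬in₁) (subst Y (c≡at j _ (toℕ<n j) refl) ¬in₂)
  ... | tri> _ _ j<i = YX.no-crossing (toℕ j) (toℕ i) (toℕ<n j) (toℕ<n i) j<i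
                         (subst Y (c≡at j _ (toℕ<n j) refl) ¬in₂) (subst X (c≡at i _ (toℕ<n i) refl) ¬in₁)
  ... | tri≈ _ i≡j _ = X⇒¬Y (subst X (cong c (toℕ-injective i≡j)) ¬in₁) ¬in₂

K-adj : ∀ {r} {a b : Fin r} → a ≢ b → Adj (K r) a b
K-adj {a = a} {b} a≢b with a ≟ b
... | yes a≡b = ⊥-elim (a≢b a≡b)
... | no _    = tt

K-adj⇒≢ : ∀ {r} {a b : Fin r} → Adj (K r) a b → a ≢ b
K-adj⇒≢ {a = a} {b} p a≡b with a ≟ b
K-adj⇒≢ () _   | yes _
K-adj⇒≢ _  a≡b | no a≢b = a≢b a≡b

-- Branch sets avoiding the separator lie entirely in G₁, as each is joined
-- by an edge to the one of c₀; paths and edges leaving G₁ are rerouted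
-- through the separator clique.  So β restricted to G₁ is still a K₅ model.
module K₅MinorRestriction {n₁ n₂ n} {G₁ : Graph n₁} {G₂ : Graph n₂} {G : Graph n} {k : ℕ}
  (cs : CliqueSum G₁ G₂ G k) (β : Fin n → Maybe (Fin 5))
  (connected : ∀ a u v → β u ≡ just a → β v ≡ just a → WalkIn G (λ w → β w ≡ just a) u v)
  (adjacent : ∀ a b → Adj (K 5) a b → ∃ λ u → ∃ λ v → β u ≡ just a × β v ≡ just b × Adj G u v)
  (nonempty : ∀ a → ∃ λ v → β v ≡ just a)
  (c₀ : Fin 5) (c₀-avoids : ∀ t → β (CliqueSum.g cs t) ≢ just c₀)
  (v₀ : Fin n) (βv₀ : β v₀ ≡ just c₀) (v₀-in₁ : InImage (CliqueSum.f₁ cs) v₀) where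
  open CliqueSum cs
  open CliqueSumProps cs
  open Props G using (Adj-sym; Adj-resp)

  Avoids : Fin 5 → Set
  Avoids a = ∀ t → β (g t) ≢ just a

  Meets : Fin 5 → Set
  Meets a = Σ (Fin (suc k)) λ t → β (g t) ≡ just a

  meets? : ∀ a → Meets a ⊎ Avoids a
  meets? a with any? (λ t → ≡-dec-Maybe _≟_ (β (g t)) (just a))
  ... | yes m  = inj₁ m
  ... | no ¬m = inj₂ (λ t e → ¬m (t , e))

  avoids⇒¬separator : ∀ {a x} → Avoids a → β x ≡ just a → ¬ Separator x
  avoids⇒¬separator av βx (t , refl) = av t βx

  walk-stays-in₁ : ∀ {Q : Fin n → Set} → (∀ {y} → Q y → ¬ Separator y) → ∀ {u v} → WalkIn G Q u v →
                   InImage f₁ u → InImage f₁ v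
  walk-stays-in₁ ¬sep (here _) iu = iu
  walk-stays-in₁ ¬sep (step {w = w} q a W) iu with in₁? w
  ... | yes iw  = walk-stays-in₁ ¬sep W iw
  ... | no ¬iw = ⊥-elim (¬sep q (exit₁ iu ¬iw a))

  in₁-¬separator⇒¬in₂ : ∀ {x} → InImage f₁ x → ¬ Separator x → ¬ InImage f₂ x
  in₁-¬separator⇒¬in₂ i₁ ¬sep i₂ = ¬sep (in₁-and-in₂⇒separator i₁ i₂)

  avoids⇒meets-G₁ : ∀ a → Avoids a → Σ (Fin n) λ u → β u ≡ just a × InImage f₁ u
  avoids⇒meets-G₁ a av with a ≟ c₀
  ... | yes refl = v₀ , βv₀ , v₀-in₁
  ... | no a≢c₀ with adjacent a c₀ (K-adj a≢c₀)
  ...   | u , v , βu , βv , uv with in₁? u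
  ...     | yes iu  = u , βu , iu
  ...     | no ¬iu = ⊥-elim (¬Adj-outside ¬iu (in₁-¬separator⇒¬in₂ iv (avoids⇒¬separator c₀-avoids βv)) uv)
    where
    iv : InImage f₁ v
    iv = walk-stays-in₁ (avoids⇒¬separator c₀-avoids) (connected c₀ v₀ v βv₀ βv) v₀-in₁

  avoids⇒in₁ : ∀ a → Avoids a → ∀ x → β x ≡ just a → InImage f₁ x
  avoids⇒in₁ a av x βx =
    let u , βu , iu = avoids⇒meets-G₁ a av in walk-stays-in₁ (avoids⇒¬separator av) (connected a u x βu βx) iu

  ¬in₁⇒meets : ∀ a x → β x ≡ just a → ¬ InImage f₁ x → Meets a
  ¬in₁⇒meets a x βx ¬ix with meets? a
  ... | inj₁ m  = m
  ... | inj₂ av = ⊥-elim (¬ix (avoids⇒in₁ a av x βx))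

  neighbour-of-¬in₁⇒meets : ∀ b x y → β y ≡ just b → ¬ InImage f₁ x → Adj G x y → Meets b
  neighbour-of-¬in₁⇒meets b x y βy ¬ix xy with in₁? y
  ... | no ¬iy = ¬in₁⇒meets b y βy ¬iy
  ... | yes iy with meets? b
  ...   | inj₁ m  = m
  ...   | inj₂ av = ⊥-elim (¬Adj-outside ¬ix (in₁-¬separator⇒¬in₂ iy (avoids⇒¬separator av βy)) xy)

  β₁ : Fin n₁ → Maybe (Fin 5)
  β₁ i = β (f₁ i)

  nonempty₁ : ∀ a → ∃ λ i → β₁ i ≡ just a
  nonempty₁ a with meets? a
  ... | inj₁ (t , βt) = let i , fi = proj₁ (inter-g t) in i , trans (cong β fi) βt
  ... | inj₂ av with nonempty a
  ...   | x , βx with avoids⇒in₁ a av x βx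
  ...     | i , refl = i , βx

  connected₁ : ∀ a i j → β₁ i ≡ just a → β₁ j ≡ just a → WalkIn G₁ (λ w → β₁ w ≡ just a) i j
  connected₁ a i j βi βj =
    Props.walk-map G₁ proj₁ (EmbeddingProps.walk-unembed embedding₁ proj₂
      (Reroute.reroute G in₁? exit₁ separator-clique (connected a (f₁ i) (f₁ j) βi βj) (i , refl) (j , refl))
      i j refl refl)

  meets-adjacent₁ : ∀ a b → a ≢ b → Meets a → Meets b →
                    ∃ λ u → ∃ λ v → β₁ u ≡ just a × β₁ v ≡ just b × Adj G₁ u v
  meets-adjacent₁ a b a≢b (s , βs) (t , βt) =
    let i , fi = proj₁ (inter-g s)
        j , fj = proj₁ (inter-g t)
    in i , j , trans (cong β fi) βs , trans (cong β fj) βt ,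
       EmbeddingProps.Adj-unembed embedding₁ (Adj-resp (sym fi) (sym fj) (clique s t s≢t))
    where
    s≢t : s ≢ t
    s≢t refl = a≢b (just-injective (trans (sym βs) βt))

  adjacent₁ : ∀ a b → Adj (K 5) a b → ∃ λ u → ∃ λ v → β₁ u ≡ just a × β₁ v ≡ just b × Adj G₁ u v
  adjacent₁ a b ab with adjacent a b ab
  ... | u , v , βu , βv , uv with in₁? u | in₁? v
  ...   | yes (i , refl) | yes (j , refl) = i , j , βu , βv , EmbeddingProps.Adj-unembed embedding₁ uv
  ...   | no ¬iu | _ =
    meets-adjacent₁ a b (K-adj⇒≢ ab) (¬in₁⇒meets a u βu ¬iu) (neighbour-of-¬in₁⇒meets b u v βv ¬iu uv)
  ...   | yes _ | no ¬iv =
    meets-adjacent₁ a b (K-adj⇒≢ ab) (neighbour-of-¬in₁⇒meets a v u βu ¬iv (Adj-sym uv)) (¬in₁⇒meets b v βv ¬iv)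

  minor₁ : HasMinor (K 5) G₁
  minor₁ = β₁ , nonempty₁ , connected₁ , adjacent₁

5≰4 : ¬ 5 ≤ 4
5≰4 (s≤s (s≤s (s≤s (s≤s ()))))

-- Five branch sets cannot all meet a separator of at most three vertices.
¬K₅-minor-cliqueSum : ∀ {n₁ n₂ n} {G₁ : Graph n₁} {G₂ : Graph n₂} {G : Graph n} {k} →
                      CliqueSum G₁ G₂ G k → k ≤ 2 →
                      ¬ HasMinor (K 5) G₁ → ¬ HasMinor (K 5) G₂ → ¬ HasMinor (K 5) G
¬K₅-minor-cliqueSum {k = k} cs k≤2 ¬m₁ ¬m₂ (β , nonempty , connected , adjacent)
  with all? (λ a → any? (λ t → ≡-dec-Maybe _≟_ (β (g t)) (just a)))
  where open CliqueSum cs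
... | yes all-meet = 5≰4 (≤-trans (injective⇒≤ meeting-injective) (s≤s (m≤n⇒m≤1+n k≤2)))
  where
  open CliqueSum cs
  meeting-injective : Injective _≡_ _≡_ (λ a → proj₁ (all-meet a))
  meeting-injective {a} {b} eq =
    just-injective (trans (sym (proj₂ (all-meet a))) (trans (cong (β ∘ g) eq) (proj₂ (all-meet b))))
... | no ¬all-meet with ¬∀⟶∃¬ _ _ (λ a → any? (λ t → ≡-dec-Maybe _≟_ (β (CliqueSum.g cs t)) (just a))) ¬all-meet
...   | c₀ , ¬meets with nonempty c₀
...     | v₀ , βv₀ with CliqueSum.cover cs v₀
...       | inj₁ v₀-in₁ = ¬m₁ (K₅MinorRestriction.minor₁ cs β connected adjacent nonempty c₀
                               (λ t e → ¬meets (t , e)) v₀ βv₀ v₀-in₁)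
...       | inj₂ v₀-in₂ = ¬m₂ (K₅MinorRestriction.minor₁ (cliqueSum-swap cs) β connected adjacent nonempty c₀
                               (λ t e → ¬meets (t , e)) v₀ βv₀ v₀-in₂)

K₅-minor⇒5≤n : ∀ {n} {G : Graph n} → HasMinor (K 5) G → 5 ≤ n
K₅-minor⇒5≤n (β , nonempty , _) = injective⇒≤ {f = proj₁ ∘ nonempty} λ {a} {b} eq →
  just-injective (trans (sym (proj₂ (nonempty a))) (trans (cong β eq) (proj₂ (nonempty b))))

complete⇒chordal : ∀ {n} (G : Graph n) → IsComplete G → Chordal G
complete⇒chordal G _ (suc zero)       _ (s≤s ())       _ _
complete⇒chordal G _ (suc (suc zero)) _ (s≤s (s≤s ())) _ _
complete⇒chordal G complete (suc (suc (suc m))) c _ (_ , c-inj , _) chl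
  with chl fz (fs (fs fz)) (complete (c fz) (c (fs (fs fz))) (λ e → 0≢2 (c-inj e)))
  where
  0≢2 : fz ≢ fs (fs fz)
  0≢2 ()
... | inj₁ ()
... | inj₂ ()

third-vertex : ∀ {r} (u v : Fin (suc (suc (suc r)))) → Σ (Fin (suc (suc (suc r)))) λ w → w ≢ u × w ≢ v
third-vertex u v with fz ≟ u | fz ≟ v
... | no 0≢u   | no 0≢v   = fz , 0≢u , 0≢v
... | yes refl | yes refl = fs fz , (λ ()) , (λ ())
... | yes refl | no _ with fs fz ≟ v
...   | no 1≢v   = fs fz , (λ ()) , 1≢v
...   | yes refl = fs (fs fz) , (λ ()) , (λ ())
third-vertex u v | no _ | yes refl with fs fz ≟ u
...   | no 1≢u   = fs fz , 1≢u , (λ ())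
...   | yes refl = fs (fs fz) , (λ ()) , (λ ())

complete⇒bridgeless : ∀ {r} (G : Graph (suc (suc (suc r)))) → IsComplete G → Bridgeless G
complete⇒bridgeless G complete u v (uv , no-cycle) =
  let w , w≢u , w≢v = third-vertex u v in
  triangle⇒¬bridge uv (complete u w (w≢u ∘ sym)) (complete v w (w≢v ∘ sym)) (uv , no-cycle)
  where open Props G

built⇒properties : ∀ {n} {G : Graph n} → Built G → Bridgeless G × Chordal G × ¬ HasMinor (K 5) G
built⇒properties (base₃ G complete) =
  complete⇒bridgeless G complete , complete⇒chordal G complete , 5≰4 ∘ m≤n⇒m≤1+n ∘ K₅-minor⇒5≤n
built⇒properties (base₄ G complete) =
  complete⇒bridgeless G complete , complete⇒chordal G complete , 5≰4 ∘ K₅-minor⇒5≤n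
built⇒properties (sum G k k≤2 built₁ built₂ cs) =
  let bl₁ , ch₁ , ¬m₁ = built⇒properties built₁
      bl₂ , ch₂ , ¬m₂ = built⇒properties built₂
  in bridgeless-cliqueSum cs bl₁ bl₂ , chordal-cliqueSum cs ch₁ ch₂ , ¬K₅-minor-cliqueSum cs k≤2 ¬m₁ ¬m₂

-- The forward direction

-- The four clique vertices are singleton branch sets and C is the fifth.
module K₄AndConnectedSet {n} (G : Graph n) (s : Fin 4 → Fin n) (s-injective : Injective _≡_ _≡_ s)
  (s-adj : ∀ i j → i ≢ j → Adj G (s i) (s j))
  {C : Fin n → Set} (C? : Decidable C) (s∉C : ∀ i → ¬ C (s i))
  (C-connected : ∀ {x y} → C x → C y → WalkIn G C x y)
  (s-adj-C : ∀ i → Σ (Fin n) λ c → C c × Adj G (s i) c) where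

  β : Fin n → Maybe (Fin 5)
  β v with C? v
  ... | yes _ = just (fromℕ 4)
  ... | no _ with any? (λ i → s i ≟ v)
  ...   | yes (i , _) = just (inject₁ i)
  ...   | no _        = nothing

  β-s : ∀ i → β (s i) ≡ just (inject₁ i)
  β-s i with C? (s i)
  ... | yes c = ⊥-elim (s∉C i c)
  ... | no _ with any? (λ j → s j ≟ s i)
  ...   | yes (j , e) = cong (just ∘ inject₁) (s-injective e)
  ...   | no ¬j       = ⊥-elim (¬j (i , refl))

  β-C : ∀ {c} → C c → β c ≡ just (fromℕ 4)
  β-C {c} cc with C? c
  ... | yes _ = refl
  ... | no ¬c = ⊥-elim (¬c cc)

  β⁻¹-s : ∀ v i → β v ≡ just (inject₁ i) → v ≡ s i
  β⁻¹-s v i eq with C? v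
  ... | yes _ = ⊥-elim (fromℕ≢inject₁ (just-injective eq))
  ... | no _ with any? (λ j → s j ≟ v)
  β⁻¹-s v i eq  | no _ | yes (j , e) = trans (sym e) (cong s (inject₁-injective (just-injective eq)))
  β⁻¹-s v i ()  | no _ | no _

  β⁻¹-C : ∀ v → β v ≡ just (fromℕ 4) → C v
  β⁻¹-C v eq with C? v
  ... | yes c = c
  ... | no _ with any? (λ j → s j ≟ v)
  β⁻¹-C v eq  | no _ | yes (j , e) = ⊥-elim (fromℕ≢inject₁ (sym (just-injective eq)))
  β⁻¹-C v ()  | no _ | no _

  K₅-minor : HasMinor (K 5) G
  K₅-minor = β , nonempty , connected , adjacent
    where
    nonempty : ∀ a → ∃ λ v → β v ≡ just a
    nonempty a with view a
    ... | ‵inject₁ i = s i , β-s i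
    ... | ‵fromℕ     = proj₁ (s-adj-C fz) , β-C (proj₁ (proj₂ (s-adj-C fz)))
    connected : ∀ a u v → β u ≡ just a → β v ≡ just a → WalkIn G (λ w → β w ≡ just a) u v
    connected a u v βu βv with view a
    ... | ‵inject₁ i with β⁻¹-s u i βu | β⁻¹-s v i βv
    ...   | refl | refl = here βu
    connected a u v βu βv | ‵fromℕ = Props.walk-map G β-C (C-connected (β⁻¹-C u βu) (β⁻¹-C v βv))
    adjacent : ∀ a b → Adj (K 5) a b → ∃ λ u → ∃ λ v → β u ≡ just a × β v ≡ just b × Adj G u v
    adjacent a b ab with view a | view b
    ... | ‵inject₁ i | ‵inject₁ j = s i , s j , β-s i , β-s j , s-adj i j (K-adj⇒≢ ab ∘ cong inject₁)
    ... | ‵inject₁ i | ‵fromℕ     =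
      let c , cc , ic = s-adj-C i in s i , c , β-s i , β-C cc , ic
    ... | ‵fromℕ     | ‵inject₁ j =
      let c , cc , jc = s-adj-C j in c , s j , β-C cc , β-s j , Props.Adj-sym G jc
    ... | ‵fromℕ     | ‵fromℕ     = ⊥-elim (K-adj⇒≢ {a = fromℕ 4} ab refl)

K₅-minor-of-K≥5 : ∀ {r} (G : Graph (5 + r)) → IsComplete G → HasMinor (K 5) G
K₅-minor-of-K≥5 {r} G complete =
  K₄AndConnectedSet.K₅-minor G s s-injective (λ i j i≢j → complete (s i) (s j) (i≢j ∘ s-injective))
    (_≟ top) s≢top (λ { refl refl → here refl }) (λ i → top , refl , complete (s i) top (s≢top i))
  where
  5≤5+r : 5 ≤ 5 + r
  5≤5+r = s≤s (s≤s (s≤s (s≤s (s≤s z≤n))))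
  s : Fin 4 → Fin (5 + r)
  s i = inject≤ (inject₁ i) 5≤5+r
  top : Fin (5 + r)
  top = inject≤ (fromℕ 4) 5≤5+r
  s-injective : Injective _≡_ _≡_ s
  s-injective e = inject₁-injective (inject≤-injective 5≤5+r 5≤5+r _ _ e)
  s≢top : ∀ i → s i ≢ top
  s≢top i e = fromℕ≢inject₁ (sym (inject≤-injective 5≤5+r 5≤5+r _ _ e))

complete⇒built : ∀ n → 2 ≤ n → (G : Graph n) → IsComplete G → Bridgeless G → Chordal G →
                 ¬ HasMinor (K 5) G → Built G
complete⇒built 1 (s≤s ()) _ _ _ _ _
complete⇒built 2 _ G complete bl ch _
  with Props.bridgeless-chordal⇒triangle G bl ch (complete fz (fs fz) (λ ()))
... | fz    , loop , _    = ⊥-elim (Props.Adj-irrefl G loop)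
... | fs fz , _    , loop = ⊥-elim (Props.Adj-irrefl G loop)
complete⇒built 3 _ G complete _ _ _ = base₃ G complete
complete⇒built 4 _ G complete _ _ _ = base₄ G complete
complete⇒built (suc (suc (suc (suc (suc r))))) _ G complete _ _ ¬m = ⊥-elim (¬m (K₅-minor-of-K≥5 G complete))

ForwardAt : ℕ → Set
ForwardAt n = (G : Graph n) → 2 ≤ n → Connected G → Bridgeless G → Chordal G → ¬ HasMinor (K 5) G → Built G

-- For non-adjacent a, b: the component C of b in G − N[a] and its boundary S
-- (the vertices outside C with a neighbour in C; they all lie in N(a)).  G is
-- the clique sum of G − C and G[C ∪ S] along S.
module Decomposition {n} (G : Graph n) (connected : Connected G) (bl : Bridgeless G) (ch : Chordal G)
  (¬m : ¬ HasMinor (K 5) G) (a b : Fin n) (a≢b : a ≢ b) (¬ab : ¬ Adj G a b) where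
  open Props G

  FarFrom-a : Fin n → Set
  FarFrom-a x = x ≢ a × ¬ Adj G a x

  farFrom-a? : Decidable FarFrom-a
  farFrom-a? x = ¬? (x ≟ a) ×-dec ¬? (adj? a x)

  C : Fin n → Set
  C x = WalkIn G FarFrom-a b x

  C? : Decidable C
  C? = walk? farFrom-a? b

  C-b : C b
  C-b = here (a≢b ∘ sym , ¬ab)

  C⇒farFrom-a : ∀ {x} → C x → FarFrom-a x
  C⇒farFrom-a = walk-last

  ¬C-a : ¬ C a
  ¬C-a c = proj₁ (C⇒farFrom-a c) refl

  C-closed : ∀ {u v} → C u → WalkIn G FarFrom-a u v → WalkIn G C u v
  C-closed cu (here _)     = here cu
  C-closed cu (step q e W) = step cu e (C-closed (walk-snoc cu e (walk-head W)) W)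

  C-connected : ∀ {x y} → C x → C y → WalkIn G C x y
  C-connected cx cy = C-closed cx (walk-++ (walk-reverse cx) cy)

  C-edge-out⇒adj-a : ∀ {c w} → C c → Adj G c w → ¬ C w → Adj G a w
  C-edge-out⇒adj-a {c} {w} cc cw ¬cw with a ≟ w
  ... | yes refl = ⊥-elim (proj₂ (C⇒farFrom-a cc) (Adj-sym cw))
  ... | no a≢w with adj? a w
  ...   | yes aw  = aw
  ...   | no ¬aw = ⊥-elim (¬cw (walk-snoc cc cw (a≢w ∘ sym , ¬aw)))

  S : Fin n → Set
  S x = ¬ C x × Σ (Fin n) λ c → C c × Adj G x c

  S? : Decidable S
  S? x = ¬? (C? x) ×-dec any? (λ c → C? c ×-dec adj? x c)

  S⇒adj-a : ∀ {s} → S s → Adj G a s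
  S⇒adj-a (¬cs , c , cc , sc) = C-edge-out⇒adj-a cc (Adj-sym sc) ¬cs

  ¬S-a : ¬ S a
  ¬S-a = Adj-irrefl ∘ S⇒adj-a

  walk-leaving-C⇒S : ∀ {Q x y} → WalkIn G Q x y → C x → ¬ C y → Σ (Fin n) S
  walk-leaving-C⇒S (here _) cx ¬cy = ⊥-elim (¬cy cx)
  walk-leaving-C⇒S (step {w = w} _ e W) cx ¬cy with C? w
  ... | yes cw  = walk-leaving-C⇒S W cw ¬cy
  ... | no ¬cw = w , ¬cw , _ , cx , Adj-sym e

  s₀ : Fin n
  s₀ = proj₁ (walk-leaving-C⇒S (connected b a) C-b ¬C-a)

  S-s₀ : S s₀
  S-s₀ = proj₂ (walk-leaving-C⇒S (connected b a) C-b ¬C-a)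

  -- An induced path from x through C to y, closed by a, would be a chordless
  -- cycle of length ≥ 4.
  S-clique : ∀ {x y} → S x → S y → x ≢ y → Adj G x y
  S-clique {x} {y} sx@(_ , cx , ccx , xcx) sy@(_ , cy , ccy , ycy) x≢y with adj? x y
  ... | yes xy  = xy
  ... | no ¬xy with walk⇒path x⇝y
    where
    x⇝y : WalkIn G (λ t → C t ⊎ t ≡ x ⊎ t ≡ y) x y
    x⇝y = step (inj₂ (inj₁ refl)) xcx
            (walk-++ (walk-map inj₁ (C-connected ccx ccy)) (step (inj₁ ccy) (Adj-sym ycy) (here (inj₂ (inj₂ refl)))))
  ...   | _ , single _                         = ⊥-elim (x≢y refl)
  ...   | _ , cons _ xy (single _) _ _        = ⊥-elim (¬xy xy)
  ...   | xs , r@(cons _ _ (cons _ _ _ _ _) _ _) =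
          ⊥-elim (ch _ cycle (s≤s (s≤s (s≤s z≤n))) cycle-isCycle (cycle-chordless only-ends))
    where
    a∉ : a ∉ xs
    a∉ mem with All.lookup (path-all r) mem
    ... | inj₁ ca          = ¬C-a ca
    ... | inj₂ (inj₁ refl) = ¬S-a sx
    ... | inj₂ (inj₂ refl) = ¬S-a sy
    open Closing a r a∉ (S⇒adj-a sx) (S⇒adj-a sy) (path-length≥2 r x≢y)
    only-ends : ∀ t → t ∈ xs → Adj G a t → t ≡ x ⊎ t ≡ y
    only-ends t mem at with All.lookup (path-all r) mem
    ... | inj₁ ct = ⊥-elim (proj₂ (C⇒farFrom-a ct) at)
    ... | inj₂ p  = p

  Side₁ : Fin n → Set
  Side₁ x = ¬ C x

  Side₂ : Fin n → Set
  Side₂ x = C x ⊎ S x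

  E₁ : Enumeration Side₁
  E₁ = enumerate (¬? ∘ C?)

  E₂ : Enumeration Side₂
  E₂ = enumerate (λ x → C? x ⊎-dec S? x)

  E-S : Enumeration S
  E-S = enumerate S?

  module E₁ = Enumeration E₁
  module E₂ = Enumeration E₂
  module E-S = Enumeration E-S

  G₁ : Graph E₁.size
  G₁ = induced G E₁

  G₂ : Graph E₂.size
  G₂ = induced G E₂

  M₁ : Embedding G₁ G
  M₁ = induced-embedding G E₁

  M₂ : Embedding G₂ G
  M₂ = induced-embedding G E₂

  size₁<n : E₁.size < n
  size₁<n = E₁.size<n b (λ ¬cb → ¬cb C-b)

  size₂<n : E₂.size < n
  size₂<n = E₂.size<n a λ { (inj₁ ca) → ¬C-a ca ; (inj₂ sa) → ¬S-a sa }

  2≤size₁ : 2 ≤ E₁.size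
  2≤size₁ = E₁.2≤size a s₀ ¬C-a (proj₁ S-s₀) (Adj⇒≢ (S⇒adj-a S-s₀))

  2≤size₂ : 2 ≤ E₂.size
  2≤size₂ = E₂.2≤size b s₀ (inj₁ C-b) (inj₂ S-s₀) (λ b≡s₀ → proj₁ S-s₀ (subst C b≡s₀ C-b))

  |S|≤3 : E-S.size ≤ 3
  |S|≤3 with E-S.size ≤? 3
  ... | yes ≤3 = ≤3
  ... | no ≰3 = ⊥-elim (¬m (K₄AndConnectedSet.K₅-minor G s s-injective
                              (λ i j i≢j → S-clique (S-s i) (S-s j) (i≢j ∘ s-injective))
                              C? (λ i → proj₁ (S-s i)) C-connected (λ i → proj₂ (S-s i))))
    where
    4≤|S| : 4 ≤ E-S.size
    4≤|S| = ≰⇒> ≰3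
    s : Fin 4 → Fin n
    s i = E-S.elem (inject≤ i 4≤|S|)
    s-injective : Injective _≡_ _≡_ s
    s-injective e = inject≤-injective 4≤|S| 4≤|S| _ _ (E-S.elem-injective e)
    S-s : ∀ i → S (s i)
    S-s i = E-S.elem-sat _

  connected₁ : Connected G₁
  connected₁ u v = Props.walk-map G₁ (λ _ → tt)
    (EmbeddingProps.walk-unembed M₁ (λ {x} p → E₁.elem-onto x (proj₂ p))
      (Reroute.reroute G (¬? ∘ C?) (λ {x} {y} ¬cx ¬¬cy xy → ¬cx , y , decidable-stable (C? y) ¬¬cy , xy) S-clique
         (connected (E₁.elem u) (E₁.elem v)) (E₁.elem-sat u) (E₁.elem-sat v)) u v refl refl)

  Side₂⇒walk-to-C : ∀ {x} → Side₂ x → Σ (Fin n) λ c → C c × WalkIn G Side₂ x c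
  Side₂⇒walk-to-C {x} (inj₁ cx)                 = x , cx , here (inj₁ cx)
  Side₂⇒walk-to-C {x} (inj₂ sx@(_ , c , cc , xc)) = c , cc , step (inj₂ sx) xc (here (inj₁ cc))

  connected₂ : Connected G₂
  connected₂ u v with Side₂⇒walk-to-C (E₂.elem-sat u) | Side₂⇒walk-to-C (E₂.elem-sat v)
  ... | cu , ccu , Wu | cv , ccv , Wv = Props.walk-map G₂ (λ _ → tt)
    (EmbeddingProps.walk-unembed M₂ (λ {x} p → E₂.elem-onto x p)
      (walk-++ Wu (walk-++ (walk-map inj₁ (C-connected ccu ccv)) (walk-reverse Wv))) u v refl refl)

  triangle-in-side⇒¬bridge : ∀ {P} (E : Enumeration P) {u v w} →
    Adj G (Enumeration.elem E u) w → Adj G (Enumeration.elem E v) w → P w →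
    Adj G (Enumeration.elem E u) (Enumeration.elem E v) → ¬ IsBridge (induced G E) u v
  triangle-in-side⇒¬bridge E {w = w} uw vw pw uv with Enumeration.elem-onto E w pw
  ... | w′ , refl = Props.triangle⇒¬bridge (induced G E) uv uw vw

  -- A triangle on an edge of G − C through C would put both ends in S, and a
  -- is then another common neighbour.
  bridgeless₁ : Bridgeless G₁
  bridgeless₁ u v (uv , no-cycle) with bridgeless-chordal⇒triangle bl ch uv
  ... | w , uw , vw with C? w
  ...   | no ¬cw = triangle-in-side⇒¬bridge E₁ uw vw ¬cw uv (uv , no-cycle)
  ...   | yes cw = triangle-in-side⇒¬bridge E₁ (Adj-sym (S⇒adj-a su)) (Adj-sym (S⇒adj-a sv)) ¬C-a uv (uv , no-cycle)
    where
    su : S (E₁.elem u)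
    su = E₁.elem-sat u , w , cw , uw
    sv : S (E₁.elem v)
    sv = E₁.elem-sat v , w , cw , vw

  -- If the triangle on an edge xy of G[C ∪ S] leaves C ∪ S, then x, y ∈ S and
  -- an induced path from x through C to y closes a cycle through xy.
  bridgeless₂ : Bridgeless G₂
  bridgeless₂ u v (uv , no-cycle) with bridgeless-chordal⇒triangle bl ch uv
  ... | w , xw , yw with C? w ⊎-dec S? w
  ...   | yes side₂-w  = triangle-in-side⇒¬bridge E₂ xw yw side₂-w uv (uv , no-cycle)
  ...   | no ¬side₂-w = both-in-S (E₂.elem-sat u) (E₂.elem-sat v)
    where
    x y : Fin n
    x = E₂.elem u
    y = E₂.elem v
    ¬C-neighbour : ∀ {t} → Adj G t w → ¬ C t
    ¬C-neighbour {t} tw ct with C? w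
    ... | yes cw  = ¬side₂-w (inj₁ cw)
    ... | no ¬cw = ¬side₂-w (inj₂ (¬cw , t , ct , Adj-sym tw))
    both-in-S : Side₂ x → Side₂ y → ⊥
    both-in-S (inj₁ cx) _        = ¬C-neighbour xw cx
    both-in-S (inj₂ _)  (inj₁ cy) = ¬C-neighbour yw cy
    both-in-S (inj₂ (¬cx , cx , ccx , xcx)) (inj₂ (¬cy , cy , ccy , ycy)) with walk⇒path cx⇝y
      where
      cx⇝y : WalkIn G (λ t → C t ⊎ t ≡ y) cx y
      cx⇝y = walk-++ (walk-map inj₁ (C-connected ccx ccy)) (step (inj₁ ccy) (Adj-sym ycy) (here (inj₂ refl)))
    ... | xs , r = EmbeddingProps.¬bridge-unembed M₂ cycle cycle-isCycle (λ i → All.lookup in-G₂ (∈-lookup i))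
                     cycle-contains-zy (uv , no-cycle)
      where
      x∉ : x ∉ xs
      x∉ mem with All.lookup (path-all r) mem
      ... | inj₁ cx  = ¬cx cx
      ... | inj₂ x≡y = Adj⇒≢ uv x≡y
      open Closing x r x∉ xcx uv (path-length≥2 r (λ cx≡y → ¬cy (subst C cx≡y ccx)))
      in-G₂ : All (InImage E₂.elem) (x ∷ xs)
      in-G₂ = (u , refl) ∷ All.map (λ { {t} (inj₁ ct) → E₂.elem-onto t (inj₁ ct) ; (inj₂ refl) → v , refl }) (path-all r)

  cliqueSum : ∀ {k} → suc k ≡ E-S.size → CliqueSum G₁ G₂ G k
  cliqueSum {k} eq = record
    { f₁ = E₁.elem ; f₂ = E₂.elem ; f₁-inj = E₁.elem-injective ; f₂-inj = E₂.elem-injective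
    ; f₁-adj = λ _ _ → refl ; f₂-adj = λ _ _ → refl
    ; cover   = cover
    ; edges   = edges
    ; g       = g ; g-inj = g-injective
    ; g-inter = g-inter
    ; inter-g = λ t → E₁.elem-onto (g t) (proj₁ (S-g t)) , E₂.elem-onto (g t) (inj₂ (S-g t))
    ; clique  = λ s t s≢t → S-clique (S-g s) (S-g t) (s≢t ∘ g-injective) }
    where
    g : Fin (suc k) → Fin n
    g t = E-S.elem (cast eq t)
    g-injective : Injective _≡_ _≡_ g
    g-injective {s} {t} e = trans (sym (cast-involutive (sym eq) eq s))
                                  (trans (cong (cast (sym eq)) (E-S.elem-injective e)) (cast-involutive (sym eq) eq t))
    S-g : ∀ t → S (g t)
    S-g t = E-S.elem-sat _
    cover : ∀ v → InImage E₁.elem v ⊎ InImage E₂.elem v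
    cover v with C? v
    ... | yes cv  = inj₂ (E₂.elem-onto v (inj₁ cv))
    ... | no ¬cv = inj₁ (E₁.elem-onto v ¬cv)
    edges : ∀ u v → Adj G u v → (InImage E₁.elem u × InImage E₁.elem v) ⊎ (InImage E₂.elem u × InImage E₂.elem v)
    edges u v e with C? u | C? v
    ... | no ¬cu | no ¬cv = inj₁ (E₁.elem-onto u ¬cu , E₁.elem-onto v ¬cv)
    ... | yes cu  | yes cv  = inj₂ (E₂.elem-onto u (inj₁ cu) , E₂.elem-onto v (inj₁ cv))
    ... | yes cu  | no ¬cv = inj₂ (E₂.elem-onto u (inj₁ cu) , E₂.elem-onto v (inj₂ (¬cv , u , cu , Adj-sym e)))
    ... | no ¬cu | yes cv  = inj₂ (E₂.elem-onto u (inj₂ (¬cu , v , cv , e)) , E₂.elem-onto v (inj₁ cv))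
    g-inter : ∀ v → InImage E₁.elem v × InImage E₂.elem v → InImage g v
    g-inter v ((i , refl) , (j , ej)) with subst Side₂ ej (E₂.elem-sat j)
    ... | inj₁ c = ⊥-elim (E₁.elem-sat i c)
    ... | inj₂ s with E-S.elem-onto v s
    ...   | t , et = cast (sym eq) t , trans (cong E-S.elem (cast-involutive eq (sym eq) t)) et

  built : (∀ {m} → m < n → ForwardAt m) → Built G
  built ih with nonempty-size (proj₁ (E-S.elem-onto s₀ S-s₀))
    where
    nonempty-size : ∀ {m} → Fin m → Σ ℕ λ k → suc k ≡ m
    nonempty-size {suc k} _ = k , refl
  ... | k , eq =
    sum G k (≤-pred (subst (_≤ 3) (sym eq) |S|≤3))
      (ih size₁<n G₁ 2≤size₁ connected₁ bridgeless₁ (chordal-unembed M₁ ch) (¬m ∘ minor-embed M₁ {K′ = K 5}))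
      (ih size₂<n G₂ 2≤size₂ connected₂ bridgeless₂ (chordal-unembed M₂ ch) (¬m ∘ minor-embed M₂ {K′ = K 5}))
      (cliqueSum eq)
    where open EmbeddingProps using (chordal-unembed; minor-embed)

¬nonadjacent⇒complete : ∀ {n} (G : Graph n) → ¬ (∃ λ a → ∃ λ b → a ≢ b × ¬ Adj G a b) → IsComplete G
¬nonadjacent⇒complete G ¬nonadjacent u v u≢v =
  decidable-stable (Props.adj? G u v) (λ ¬uv → ¬nonadjacent (u , v , u≢v , ¬uv))

properties⇒built : ∀ n → ForwardAt n
properties⇒built = <-rec ForwardAt λ n ih G 2≤n connected bl ch ¬m →
  case any? (λ a → any? (λ b → ¬? (a ≟ b) ×-dec ¬? (Props.adj? G a b))) of λ where
    (yes (a , b , a≢b , ¬ab)) → Decomposition.built G connected bl ch ¬m a b a≢b ¬ab ih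
    (no ¬nonadjacent) → complete⇒built n 2≤n G (¬nonadjacent⇒complete G ¬nonadjacent) bl ch ¬m

proposition3p5 : (n : ℕ) → 2 ≤ n → (G : Graph n) → Connected G →
    ((Bridgeless G × Chordal G × ¬ HasMinor (K 5) G) ⇔ Built G)
proposition3p5 n 2≤n G connected =
  mk⇔ (λ (bl , ch , ¬m) → properties⇒built n G 2≤n connected bl ch ¬m) built⇒properties
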